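{- Language Edit Distance (with insertions, deletions and substitutions, and also the variant with only insertions and deletions) and RNA-folding can be reduced to scored parsing problems of $1$-BD scored grammars: given a context-free grammar $G$ in Chomsky normal form, one can construct a $1$-BD scored grammar $G'$ with start symbol $S'$, of size polynomial in $|G|$, such that for every terminal string $\sigma$ the (respective) language edit distance of $\sigma$ to $L(G)$ equals $s_{G'}(S',\sigma)$; in particular, the input string is not changed by the reduction.
   Context: A scored grammar is a context-free grammar in which each production has a non-negative integer score; $s_{G'}(X,\sigma)$ is the minimum total score of a derivation of the terminal string $\sigma$ from nonterminal $X$. It is $1$-BD if for every nonterminal $X$, terminal $x$ and non-empty terminal string $\sigma$: $|s(X,\sigma)-s(X,\sigma x)|\le 1$ and $|s(X,\sigma)-s(X,x\sigma)|\le 1$. Chomsky normal form: all productions are $Z\to XY$, $Z\to c$, or $S\to\varepsilon$, with $X,Y$ non-start nonterminals and $c$ a terminal. Language edit distance of $\sigma$ to $L(G)$: minimum number of unit-cost edit operations (insertions, deletions, substitutions of single terminals; or only insertions and deletions in the variant) turning $\sigma$ into a string of $L(G)$. RNA-folding: for alphabet $\Sigma$ with matching letters $\Sigma'=\{c'\mid c\in\Sigma\}$, the maximum number of disjoint non-crossing matching pairs in a string over $\Sigma\cup\Sigma'$; it equals $(|\sigma|-d)/2$ where $d$ is the insertion/deletion edit distance of $\sigma$ to the language of the grammar with productions $S\to SS\mid\varepsilon$ and $S\to cSc'\mid c'Sc$ for all $c\in\Sigma$. -}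

module Defs where

open import Data.Nat using (ℕ; zero; suc; _+_; _*_; _≤_; _<_)
open import Data.Nat.ListAction using (sum)
open import Data.Fin as F using (Fin)
open import Data.List using (List; []; _∷_; _++_; _∷ʳ_; length; map; lookup)
open import Data.List.Membership.Propositional using (_∈_)
open import Data.List.Relation.Unary.All using (All)
open import Data.Product using (Σ; ∃; _×_; _,_)
open import Data.Sum using (_⊎_; inj₁; inj₂)
open import Data.Bool using (Bool; true)
open import Relation.Binary.PropositionalEquality using (_≡_; _≢_)
open import Relation.Nullary using (¬_)
open import Function.Bundles using (_⇔_)

-- Context-free grammars in Chomsky normal form over terminal type T.
-- Nonterminals are Fin N.  Productions:  Z → X Y  (X, Y non-start),
-- Z → c,  and optionally  S → ε  (flag startEps).

record CNF (T : Set) : Set where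
  field
    N         : ℕ
    start     : Fin N
    binRules  : List (Fin N × Fin N × Fin N)     -- (Z , X , Y) : Z → X Y
    termRules : List (Fin N × T)                 -- (Z , c)     : Z → c
    startEps  : Bool                             -- S → ε present?
    binNonStart : All (λ { (z , x , y) → x ≢ start × y ≢ start }) binRules

open CNF public

data CNFGen {T : Set} (G : CNF T) : Fin (N G) → List T → Set where
  gen-term : ∀ {Z c} → (Z , c) ∈ termRules G → CNFGen G Z (c ∷ [])
  gen-bin  : ∀ {Z X Y σ τ} → (Z , X , Y) ∈ binRules G →
             CNFGen G X σ → CNFGen G Y τ → CNFGen G Z (σ ++ τ)
  gen-eps  : startEps G ≡ true → CNFGen G (start G) []

Lang : {T : Set} → CNF T → List T → Set
Lang G σ = CNFGen G (start G) σ

cnfSize : ∀ {t} → CNF (Fin t) → ℕ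
cnfSize {t} G = t + N G + length (binRules G) + length (termRules G) + 1

record ScoredGrammar (T : Set) : Set where
  field
    SN     : ℕ
    sstart : Fin SN
    prods  : List (Fin SN × List (Fin SN ⊎ T) × ℕ)   -- (X , rhs , score)

open ScoredGrammar public

mutual
  data SDerives {T : Set} (G : ScoredGrammar T) : Fin (SN G) → List T → ℕ → Set where
    sder : ∀ {X rhs w σ c} → (X , rhs , w) ∈ prods G →
           SDerivesSeq G rhs σ c → SDerives G X σ (w + c)

  data SDerivesSeq {T : Set} (G : ScoredGrammar T) : List (Fin (SN G) ⊎ T) → List T → ℕ → Set where
    snil  : SDerivesSeq G [] [] 0
    sterm : ∀ {a rest σ c} → SDerivesSeq G rest σ c →
            SDerivesSeq G (inj₂ a ∷ rest) (a ∷ σ) c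
    snt   : ∀ {X rest σ τ c d} → SDerives G X σ c → SDerivesSeq G rest τ d →
            SDerivesSeq G (inj₁ X ∷ rest) (σ ++ τ) (c + d)

-- s_G(X,σ) = d : d is the minimum total score of a derivation of σ from X.
-- (If σ has no derivation from X, s_G(X,σ) = ∞ and no d satisfies this.)
HasScore : {T : Set} (G : ScoredGrammar T) → Fin (SN G) → List T → ℕ → Set
HasScore G X σ d = SDerives G X σ d × (∀ d' → SDerives G X σ d' → d ≤ d')

sgSize : {T : Set} → ScoredGrammar T → ℕ
sgSize G = SN G + sum (map (λ { (_ , rhs , _) → suc (length rhs) }) (prods G))

-- Two (possibly infinite) scores differ by at most 1
-- (∞ is only within distance 1 of ∞).
Close : {T : Set} (G : ScoredGrammar T) → Fin (SN G) → List T → List T → Set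
Close G X σ τ =
  (∀ d → HasScore G X σ d → ∃ λ e → HasScore G X τ e × d ≤ suc e × e ≤ suc d) ×
  (∀ e → HasScore G X τ e → ∃ λ d → HasScore G X σ d × d ≤ suc e × e ≤ suc d)

OneBD : {T : Set} → ScoredGrammar T → Set
OneBD {T} G = ∀ (X : Fin (SN G)) (x : T) (σ : List T) → σ ≢ [] →
  Close G X σ (σ ∷ʳ x) × Close G X σ (x ∷ σ)

data EditStep {T : Set} : List T → List T → Set where
  ins : ∀ u v c   → EditStep (u ++ v) (u ++ c ∷ v)
  del : ∀ u v c   → EditStep (u ++ c ∷ v) (u ++ v)
  sub : ∀ u v c c' → EditStep (u ++ c ∷ v) (u ++ c' ∷ v)

data IndelStep {T : Set} : List T → List T → Set where
  ins : ∀ u v c → IndelStep (u ++ v) (u ++ c ∷ v)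
  del : ∀ u v c → IndelStep (u ++ c ∷ v) (u ++ v)

data Steps {T : Set} (R : List T → List T → Set) : List T → List T → ℕ → Set where
  done : ∀ {σ} → Steps R σ σ 0
  step : ∀ {σ ρ τ n} → R σ ρ → Steps R ρ τ n → Steps R σ τ (suc n)

-- The edit distance (w.r.t. step relation R) of σ to the language P is d.
-- (If P is empty the distance is ∞ and no d satisfies this.)
IsDist : {T : Set} (R : List T → List T → Set) (P : List T → Set) → List T → ℕ → Set
IsDist R P σ d =
  (∃ λ τ → P τ × Steps R σ τ d) × (∀ τ n → P τ → Steps R σ τ n → d ≤ n)

-- RNA folding over alphabet Σ = Fin m; letters c are inj₁ c, c' are inj₂ c.

RNAChar : ℕ → Set
RNAChar m = Fin m ⊎ Fin m

data RNALang {m : ℕ} : List (RNAChar m) → Set where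
  r-eps  : RNALang []
  r-cat  : ∀ {σ τ} → RNALang σ → RNALang τ → RNALang (σ ++ τ)
  r-pair : ∀ {c σ} → RNALang σ → RNALang (inj₁ c ∷ σ ++ inj₂ c ∷ [])
  r-pair' : ∀ {c σ} → RNALang σ → RNALang (inj₂ c ∷ σ ++ inj₁ c ∷ [])

Matches : ∀ {m} → RNAChar m → RNAChar m → Set
Matches x y = ∃ λ c → (x ≡ inj₁ c × y ≡ inj₂ c) ⊎ (x ≡ inj₂ c × y ≡ inj₁ c)

Compatible : ∀ {n} → Fin n × Fin n → Fin n × Fin n → Set
Compatible (i , j) (k , l) =
  i ≢ k × i ≢ l × j ≢ k × j ≢ l × ¬ (i F.< k × k F.< j × j F.< l)

IsFolding : ∀ {m} (σ : List (RNAChar m)) → List (Fin (length σ) × Fin (length σ)) → Set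
IsFolding σ ps =
  All (λ { (i , j) → i F.< j × Matches (lookup σ i) (lookup σ j) }) ps ×
  (∀ (a b : Fin (length ps)) → a ≢ b → Compatible (lookup ps a) (lookup ps b))

IsRNAFold : ∀ {m} → List (RNAChar m) → ℕ → Set
IsRNAFold σ k =
  (∃ λ ps → IsFolding σ ps × length ps ≡ k) ×
  (∀ ps → IsFolding σ ps → length ps ≤ k)

module Submission where

-- For a CNF grammar G and b ∈ {substitutions allowed, indels only} we build a
-- scored grammar G′ on the nonterminals of G: the rules of G with score 0 plus
-- the error rules Z → ε (and, with substitutions, Z → a) for every terminal
-- rule Z → c, and Z → a Z, Z → Z a for every Z and letter a, all of score 1.
-- Its derivations are captured by an inductive relation Relaxed Z σ s.  A
-- relaxed derivation of score s is read off as an edit script of length ≤ s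
-- from σ into L(Z) (to-script); conversely undoing one edit step costs at most
-- one (drop-letter, add-letter, change-letter), so every script of length n
-- gives a derivation of score ≤ n (from-script).  Hence s_{G′}(Z,σ) is the
-- edit distance of σ to L(Z) (Distance.minimal-score⇔distance).  Since
-- bounded reachability is decidable (finite alphabet, CYK decision of L(Z)),
-- minimal scripts exist, and the distance is 1-Lipschitz along a step, which
-- gives 1-BD (oneBD-from-distance).  The RNA grammar S → S S | ε | c S c′ |
-- c′ S c (score 0) | a S (score 1) is treated in the same way.  Finally a
-- derivation of score s yields a folding with k pairs where |σ| ≤ s + 2k, and
-- a folding with k pairs yields a derivation of score s with s + 2k ≤ |σ|, so
-- if the RNA-folding value is k then the score is |σ| - 2k.

open import Data.Bool using (Bool; true; false)
open import Data.Bool.Properties using () renaming (_≟_ to _≟ᵇ_)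
open import Data.Empty using (⊥; ⊥-elim)
open import Data.Fin as F using (Fin; zero; suc; toℕ; fromℕ<) renaming (_≟_ to _≟ᶠ_)
open import Data.Fin.Properties using (toℕ-fromℕ<; toℕ-injective)
open import Data.List using (List; []; _∷_; _++_; _∷ʳ_; [_]; length; map; concatMap; allFin; filter; lookup)
open import Data.List.Properties
  using (++-assoc; ++-identityʳ; ∷-injective; ++-conicalˡ; length-++; length-map; length-tabulate;
         tabulate-lookup; length-++-≤ˡ; length-++-≤ʳ; length-++-sucʳ)
open import Data.List.Membership.Propositional using (_∈_; find; lose)
open import Data.List.Membership.Propositional.Properties
  using (∈-map⁺; ∈-map⁻; ∈-++⁺ˡ; ∈-++⁺ʳ; ∈-++⁻; ∈-concatMap⁺; ∈-concatMap⁻; ∈-allFin; ∈-filter⁻;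
         ∈-lookup)
open import Data.List.Relation.Unary.Any using (Any; here; there; any?)
open import Data.List.Relation.Unary.All as All using (All; []; _∷_) renaming (lookup to lookupAll)
import Data.List.Relation.Unary.All.Properties as All
open import Data.List.Relation.Unary.AllPairs as AllPairs using (AllPairs; []; _∷_)
import Data.List.Relation.Unary.AllPairs.Properties as AllPairs
open import Data.Maybe using (Maybe; just; nothing)
open import Data.Maybe.Properties using (just-injective)
open import Data.Nat using (ℕ; zero; suc; _+_; _*_; _∸_; _^_; _≤_; _<_; z≤n; s≤s; _≤?_; _<?_)
  renaming (_≟_ to _≟ⁿ_)
open import Data.Nat.ListAction using (sum)
open import Data.Nat.Tactic.RingSolver using (solve-∀)
open import Data.Nat.Properties
  using (≤-refl; ≤-reflexive; ≤-trans; ≤-antisym; ≤-pred; ≮⇒≥; m≤n⇒m<n∨m≡n; n≤1+n; m≤n⇒m≤1+n;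
         +-identityʳ; +-suc; +-comm; +-monoˡ-≤; +-monoʳ-≤; +-mono-≤; <-≤-trans;
         *-identityʳ; *-mono-≤; *-monoˡ-≤; *-monoʳ-≤; m≤m+n; m≤n+m; m≤n⇒m≤n+o; module ≤-Reasoning;
         +-cancelˡ-≡; +-cancelˡ-<; +-monoʳ-<; <-irrefl; <-asym; <-trans; m+[n∸m]≡n; ≤∧≢⇒<;
         m≤n+o⇒m∸n≤o; m+n≤o⇒m≤o∸n)
open import Data.Product using (Σ; ∃; _×_; _,_; proj₁; proj₂; map₁)
open import Data.Product.Properties using (≡-dec)
open import Data.Sum using (_⊎_; inj₁; inj₂; [_,_]′)
open import Function.Bundles using (_⇔_; mk⇔; Equivalence)
open import Relation.Nullary using (¬_; Dec; yes; no; does; ¬?)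
open import Relation.Unary using (Decidable)
open import Relation.Nullary.Decidable using (map′; _×-dec_; _⊎-dec_)
open import Relation.Binary.PropositionalEquality using (_≡_; _≢_; refl; sym; trans; cong; cong₂; subst; subst₂)
open import Defs

module _ {A : Set} where

  ++-cut : ∀ (σ τ u v : List A) → σ ++ τ ≡ u ++ v →
    (∃ λ m → u ≡ σ ++ m × τ ≡ m ++ v) ⊎ (∃ λ m → σ ≡ u ++ m × v ≡ m ++ τ)
  ++-cut [] τ u v eq = inj₁ (u , refl , eq)
  ++-cut (x ∷ σ) τ [] v eq = inj₂ (x ∷ σ , refl , sym eq)
  ++-cut (x ∷ σ) τ (y ∷ u) v eq with ∷-injective eq
  ... | refl , eq′ with ++-cut σ τ u v eq′
  ...   | inj₁ (m , e₁ , e₂) = inj₁ (m , cong (x ∷_) e₁ , e₂)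
  ...   | inj₂ (m , e₁ , e₂) = inj₂ (m , cong (x ∷_) e₁ , e₂)

  ++-letter : ∀ (σ τ u : List A) c v → σ ++ τ ≡ u ++ c ∷ v →
    (∃ λ v′ → σ ≡ u ++ c ∷ v′ × v ≡ v′ ++ τ) ⊎ (∃ λ u′ → τ ≡ u′ ++ c ∷ v × u ≡ σ ++ u′)
  ++-letter σ τ u c v eq with ++-cut σ τ u (c ∷ v) eq
  ... | inj₁ (m , e₁ , e₂) = inj₂ (m , e₂ , e₁)
  ... | inj₂ ([] , e₁ , e₂) =
    inj₂ ([] , sym e₂ , trans (sym (++-identityʳ u)) (trans (sym e₁) (sym (++-identityʳ σ))))
  ... | inj₂ (x ∷ m , e₁ , e₂) with ∷-injective e₂
  ...   | refl , e₃ = inj₁ (m , e₁ , e₃)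

  []≢++∷ : ∀ (u : List A) c v → ¬ ([] ≡ u ++ c ∷ v)
  []≢++∷ [] c v ()
  []≢++∷ (x ∷ u) c v ()

  cuts : List A → List (List A × List A)
  cuts [] = ([] , []) ∷ []
  cuts (x ∷ xs) = ([] , x ∷ xs) ∷ map (map₁ (x ∷_)) (cuts xs)

  cuts-sound : ∀ σ {u v} → (u , v) ∈ cuts σ → u ++ v ≡ σ
  cuts-sound [] (here refl) = refl
  cuts-sound (x ∷ σ) (here refl) = refl
  cuts-sound (x ∷ σ) (there m) with ∈-map⁻ (map₁ (x ∷_)) m
  ... | _ , m′ , refl = cong (x ∷_) (cuts-sound σ m′)

  cuts-complete : ∀ u v → (u , v) ∈ cuts (u ++ v)
  cuts-complete [] [] = here refl
  cuts-complete [] (x ∷ v) = here refl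
  cuts-complete (x ∷ u) v = there (∈-map⁺ (map₁ (x ∷_)) (cuts-complete u v))

  left-shorter : ∀ (σ : List A) y τ → length σ < length (σ ++ y ∷ τ)
  left-shorter σ y τ = subst (length σ <_) (sym (length-++-sucʳ σ y τ)) (s≤s (length-++-≤ˡ σ))

  right-shorter : ∀ x (σ τ : List A) → length τ < length (x ∷ σ ++ τ)
  right-shorter x σ τ = s≤s (length-++-≤ʳ τ {σ})

module ∈-Elim {B : Set} (P : B → Set) where

  ∈-++-elim : ∀ xs {ys p} → (p ∈ xs → P p) → (p ∈ ys → P p) → p ∈ xs ++ ys → P p
  ∈-++-elim xs left right m with ∈-++⁻ xs m
  ... | inj₁ m′ = left m′
  ... | inj₂ m′ = right m′

  ∈-map-elim : ∀ {A : Set} (f : A → B) {xs p} → (∀ {x} → x ∈ xs → P (f x)) → p ∈ map f xs → P p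
  ∈-map-elim f elim m with ∈-map⁻ f m
  ... | x , x∈ , refl = elim x∈

  ∈-concatMap-elim : ∀ {A : Set} (f : A → List B) {xs p} →
                     (∀ {x} → x ∈ xs → p ∈ f x → P p) → p ∈ concatMap f xs → P p
  ∈-concatMap-elim f {xs} elim m with find (∈-concatMap⁻ f {xs = xs} m)
  ... | x , x∈ , m′ = elim x∈ m′

module _ {A B : Set} where

  length-concatMap : ∀ (f : A → List B) k → (∀ x → length (f x) ≡ k) → ∀ xs →
                     length (concatMap f xs) ≡ length xs * k
  length-concatMap f k fx≡k [] = refl
  length-concatMap f k fx≡k (x ∷ xs) =
    trans (length-++ (f x)) (cong₂ _+_ (fx≡k x) (length-concatMap f k fx≡k xs))

length-++-mono : ∀ {A : Set} (xs ys : List A) {m n} →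
                 length xs ≤ m → length ys ≤ n → length (xs ++ ys) ≤ m + n
length-++-mono xs ys xs≤ ys≤ = ≤-trans (≤-reflexive (length-++ xs)) (+-mono-≤ xs≤ ys≤)

length-allFin : ∀ n → length (allFin n) ≡ n
length-allFin n = length-tabulate (λ i → i)

length-map-allFin : ∀ {A : Set} {n} (f : Fin n → A) → length (map f (allFin n)) ≡ n
length-map-allFin {n = n} f = trans (length-map f (allFin n)) (length-allFin n)

length-filter-split : ∀ {A : Set} {P : A → Set} (P? : Decidable P) xs →
  length xs ≡ length (filter P? xs) + length (filter (λ x → ¬? (P? x)) xs)
length-filter-split P? [] = refl
length-filter-split P? (x ∷ xs) with does (P? x)
... | true = cong suc (length-filter-split P? xs)
... | false = trans (cong suc (length-filter-split P? xs)) (sym (+-suc _ _))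

allPairs-∈ : ∀ {A : Set} {R : A → A → Set} {xs p q} →
             AllPairs R xs → p ∈ xs → q ∈ xs → p ≢ q → R p q ⊎ R q p
allPairs-∈ (_ ∷ _) (here refl) (here refl) p≢q = ⊥-elim (p≢q refl)
allPairs-∈ (Rx ∷ _) (here refl) (there q∈) _ = inj₁ (lookupAll Rx q∈)
allPairs-∈ (Rx ∷ _) (there p∈) (here refl) _ = inj₂ (lookupAll Rx p∈)
allPairs-∈ (_ ∷ rest) (there p∈) (there q∈) p≢q = allPairs-∈ rest p∈ q∈ p≢q

within-mono : ∀ {D : ℕ → Set} {k n} → k ≤ n → (∃ λ s → s ≤ suc k × D s) → ∃ λ s → s ≤ suc n × D s
within-mono k≤n (s , s≤ , d) = s , ≤-trans s≤ (s≤s k≤n) , d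

-- A decidable predicate on ℕ that holds somewhere holds at a least point.
-- This produces the minima demanded by HasScore and IsDist.
least-witness : {P : ℕ → Set} → (∀ n → Dec (P n)) → ∀ {m} → P m →
  ∃ λ n → P n × (∀ j → P j → n ≤ j)
least-witness {P} P? {m} pm = search 0 m (λ _ ()) (subst P (sym (+-identityʳ m)) pm)
  where
  search : ∀ k gap → (∀ j → j < k → ¬ P j) → P (gap + k) → ∃ λ n → P n × (∀ j → P j → n ≤ j)
  search k zero none pk = k , pk , λ j pj → ≮⇒≥ (λ j<k → none j j<k pj)
  search k (suc gap) none p with P? k
  ... | yes pk = k , pk , λ j pj → ≮⇒≥ (λ j<k → none j j<k pj)
  ... | no ¬pk = search (suc k) gap none′ (subst P (sym (+-suc gap k)) p)
    where
    none′ : ∀ j → j < suc k → ¬ P j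
    none′ j j<1+k with m≤n⇒m<n∨m≡n (≤-pred j<1+k)
    ... | inj₁ j<k = none j j<k
    ... | inj₂ refl = ¬pk

module _ {T : Set} {R : List T → List T → Set} where

  _▸_ : ∀ {a b c n m} → Steps R a b n → Steps R b c m → Steps R a c (n + m)
  done ▸ q = q
  step r p ▸ q = step r (p ▸ q)

  steps-map : (f : List T → List T) → (∀ {a b} → R a b → R (f a) (f b)) →
              ∀ {a b n} → Steps R a b n → Steps R (f a) (f b) n
  steps-map f lift done = done
  steps-map f lift (step r p) = step (lift r) (steps-map f lift p)

Step : {T : Set} → Bool → List T → List T → Set
Step true = EditStep
Step false = IndelStep

module _ {T : Set} where

  insertion : ∀ b (u v : List T) c → Step b (u ++ v) (u ++ c ∷ v)
  insertion true = ins
  insertion false = ins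

  deletion : ∀ b (u v : List T) c → Step b (u ++ c ∷ v) (u ++ v)
  deletion true = del
  deletion false = del

  step-ctxˡ : ∀ b w {a c : List T} → Step b a c → Step b (w ++ a) (w ++ c)
  step-ctxˡ true w (ins u v c) =
    subst₂ EditStep (++-assoc w u v) (++-assoc w u (c ∷ v)) (ins (w ++ u) v c)
  step-ctxˡ true w (del u v c) =
    subst₂ EditStep (++-assoc w u (c ∷ v)) (++-assoc w u v) (del (w ++ u) v c)
  step-ctxˡ true w (sub u v c c′) =
    subst₂ EditStep (++-assoc w u (c ∷ v)) (++-assoc w u (c′ ∷ v)) (sub (w ++ u) v c c′)
  step-ctxˡ false w (ins u v c) =
    subst₂ IndelStep (++-assoc w u v) (++-assoc w u (c ∷ v)) (ins (w ++ u) v c)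
  step-ctxˡ false w (del u v c) =
    subst₂ IndelStep (++-assoc w u (c ∷ v)) (++-assoc w u v) (del (w ++ u) v c)

  step-ctxʳ : ∀ b w {a c : List T} → Step b a c → Step b (a ++ w) (c ++ w)
  step-ctxʳ true w (ins u v c) =
    subst₂ EditStep (sym (++-assoc u v w)) (sym (++-assoc u (c ∷ v) w)) (ins u (v ++ w) c)
  step-ctxʳ true w (del u v c) =
    subst₂ EditStep (sym (++-assoc u (c ∷ v) w)) (sym (++-assoc u v w)) (del u (v ++ w) c)
  step-ctxʳ true w (sub u v c c′) =
    subst₂ EditStep (sym (++-assoc u (c ∷ v) w)) (sym (++-assoc u (c′ ∷ v) w)) (sub u (v ++ w) c c′)
  step-ctxʳ false w (ins u v c) =
    subst₂ IndelStep (sym (++-assoc u v w)) (sym (++-assoc u (c ∷ v) w)) (ins u (v ++ w) c)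
  step-ctxʳ false w (del u v c) =
    subst₂ IndelStep (sym (++-assoc u (c ∷ v) w)) (sym (++-assoc u v w)) (del u (v ++ w) c)

  append-step : ∀ b (σ : List T) x → Step b σ (σ ∷ʳ x)
  append-step b σ x = subst (λ a → Step b a (σ ∷ʳ x)) (++-identityʳ σ) (insertion b σ [] x)

  unappend-step : ∀ b (σ : List T) x → Step b (σ ∷ʳ x) σ
  unappend-step b σ x = subst (Step b (σ ∷ʳ x)) (++-identityʳ σ) (deletion b σ [] x)

-- Over a finite alphabet every word has finitely many successors under a
-- step, so bounded reachability of a decidable language is decidable.
module Reachability {T : Set} (letters : List T) (letters-complete : ∀ x → x ∈ letters) where

  insertionsAt : List T → List T → List (List T)
  insertionsAt u v = map (λ x → u ++ x ∷ v) letters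

  removalsAt : Bool → List T → List T → List (List T)
  removalsAt b u [] = []
  removalsAt true u (c ∷ v) = (u ++ v) ∷ insertionsAt u v
  removalsAt false u (c ∷ v) = (u ++ v) ∷ []

  editsAt : Bool → List T × List T → List (List T)
  editsAt b (u , v) = insertionsAt u v ++ removalsAt b u v

  successors : Bool → List T → List (List T)
  successors b σ = concatMap (editsAt b) (cuts σ)

  editsAt-sound : ∀ b u v {ρ} → ρ ∈ editsAt b (u , v) → Step b (u ++ v) ρ
  editsAt-sound b u v m with ∈-++⁻ (insertionsAt u v) m
  ... | inj₁ m′ with ∈-map⁻ (λ x → u ++ x ∷ v) m′
  ...   | x , _ , refl = insertion b u v x
  editsAt-sound true u (c ∷ v) m | inj₂ (here refl) = del u v c
  editsAt-sound true u (c ∷ v) m | inj₂ (there m′) with ∈-map⁻ (λ x → u ++ x ∷ v) m′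
  ...   | x , _ , refl = sub u v c x
  editsAt-sound false u (c ∷ v) m | inj₂ (here refl) = del u v c

  successors-sound : ∀ b {σ ρ} → ρ ∈ successors b σ → Step b σ ρ
  successors-sound b {σ} m with find (∈-concatMap⁻ (editsAt b) {xs = cuts σ} m)
  ... | (u , v) , uv∈ , m′ = subst (λ a → Step b a _) (cuts-sound σ uv∈) (editsAt-sound b u v m′)

  private
    at : ∀ b u v {ρ} → ρ ∈ editsAt b (u , v) → ρ ∈ successors b (u ++ v)
    at b u v m = ∈-concatMap⁺ (editsAt b) (lose (cuts-complete u v) m)

    inserted : ∀ u v c → (u ++ c ∷ v) ∈ insertionsAt u v
    inserted u v c = ∈-map⁺ (λ x → u ++ x ∷ v) (letters-complete c)

  successors-complete : ∀ b {σ ρ} → Step b σ ρ → ρ ∈ successors b σ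
  successors-complete true (ins u v c) = at true u v (∈-++⁺ˡ (inserted u v c))
  successors-complete true (del u v c) = at true u (c ∷ v) (∈-++⁺ʳ _ (here refl))
  successors-complete true (sub u v c c′) = at true u (c ∷ v) (∈-++⁺ʳ _ (there (inserted u v c′)))
  successors-complete false (ins u v c) = at false u v (∈-++⁺ˡ (inserted u v c))
  successors-complete false (del u v c) = at false u (c ∷ v) (∈-++⁺ʳ _ (here refl))

  reachable : Bool → List T → ℕ → List (List T)
  reachable b σ zero = [ σ ]
  reachable b σ (suc n) = concatMap (λ ρ → reachable b ρ n) (successors b σ)

  reachable-sound : ∀ b σ n {τ} → τ ∈ reachable b σ n → Steps (Step b) σ τ n
  reachable-sound b σ zero (here refl) = done
  reachable-sound b σ (suc n) m with find (∈-concatMap⁻ (λ ρ → reachable b ρ n) {xs = successors b σ} m)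
  ... | ρ , ρ∈ , m′ = step (successors-sound b ρ∈) (reachable-sound b ρ n m′)

  reachable-complete : ∀ b {σ τ n} → Steps (Step b) σ τ n → τ ∈ reachable b σ n
  reachable-complete b done = here refl
  reachable-complete b (step {n = n} r p) =
    ∈-concatMap⁺ (λ ρ → reachable b ρ n) (lose (successors-complete b r) (reachable-complete b p))

  reach? : {L : List T → Set} → (∀ τ → Dec (L τ)) →
           ∀ b σ n → Dec (∃ λ τ → L τ × Steps (Step b) σ τ n)
  reach? {L} L? b σ n = map′ found hit (any? L? (reachable b σ n))
    where
    found : Any L (reachable b σ n) → ∃ λ τ → L τ × Steps (Step b) σ τ n
    found a with find a
    ... | τ , m , l = τ , l , reachable-sound b σ n m
    hit : (∃ λ τ → L τ × Steps (Step b) σ τ n) → Any L (reachable b σ n)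
    hit (τ , l , p) = lose (reachable-complete b p) l

module Distance {T : Set} (R : List T → List T → Set) (L : List T → Set) where

  minimal-score⇔distance :
    (Derivable : List T → ℕ → Set) →
    (∀ {σ s} → Derivable σ s → ∃ λ τ → ∃ λ n → L τ × Steps R σ τ n × n ≤ s) →
    (∀ {σ τ n} → L τ → Steps R σ τ n → ∃ λ s → s ≤ n × Derivable σ s) →
    ∀ σ d → (Derivable σ d × (∀ d′ → Derivable σ d′ → d ≤ d′)) ⇔ IsDist R L σ d
  minimal-score⇔distance Derivable to-edits from-edits σ d = mk⇔ to from
    where
    to : Derivable σ d × (∀ d′ → Derivable σ d′ → d ≤ d′) → IsDist R L σ d
    to (der , minimal) with to-edits der
    ... | τ , n , τ∈L , script , n≤d with from-edits τ∈L script
    ...   | s , s≤n , der′ =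
      (τ , τ∈L , subst (Steps R σ τ) (≤-antisym n≤d (≤-trans (minimal s der′) s≤n)) script) ,
      λ τ′ n′ τ′∈L script′ → let (s′ , s′≤n′ , der″) = from-edits τ′∈L script′
                             in ≤-trans (minimal s′ der″) s′≤n′
    from : IsDist R L σ d → Derivable σ d × (∀ d′ → Derivable σ d′ → d ≤ d′)
    from ((τ , τ∈L , script) , shortest) with from-edits τ∈L script
    ... | s , s≤d , der with to-edits der
    ...   | τ′ , n′ , τ′∈L , script′ , n′≤s =
      subst (Derivable σ) (≤-antisym s≤d (≤-trans (shortest τ′ n′ τ′∈L script′) n′≤s)) der ,
      λ d′ der′ → let (τ″ , n″ , τ″∈L , script″ , n″≤d′) = to-edits der′
                  in ≤-trans (shortest τ″ n″ τ″∈L script″) n″≤d′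

  -- Edit distance is 1-Lipschitz along a step that can be undone in one step.
  -- The new distance is the least length of a script from ρ, found by search.
  distance-lipschitz : (∀ σ n → Dec (∃ λ τ → L τ × Steps R σ τ n)) →
    ∀ {σ ρ d} → R σ ρ → R ρ σ → IsDist R L σ d →
    ∃ λ e → IsDist R L ρ e × d ≤ suc e × e ≤ suc d
  distance-lipschitz reach? {σ} {ρ} {d} σ→ρ ρ→σ ((τ , τ∈L , σ→τ) , shortest)
    with least-witness (reach? ρ) (τ , τ∈L , step ρ→σ σ→τ)
  ... | e , (τ′ , τ′∈L , ρ→τ′) , least =
    e , ((τ′ , τ′∈L , ρ→τ′) , λ τ″ n τ″∈L ρ→τ″ → least n (τ″ , τ″∈L , ρ→τ″)) ,
    shortest τ′ (suc e) τ′∈L (step σ→ρ ρ→τ′) , least (suc d) (τ , τ∈L , step ρ→σ σ→τ)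

sum-map-bound : ∀ {A : Set} (f : A → ℕ) k {xs} → All (λ x → f x ≤ k) xs → sum (map f xs) ≤ length xs * k
sum-map-bound f k [] = z≤n
sum-map-bound f k (fx≤k ∷ rest) = +-mono-≤ fx≤k (sum-map-bound f k rest)

sgSize-bound : ∀ {T} (G : ScoredGrammar T) k →
  All (λ p → suc (length (proj₁ (proj₂ p))) ≤ k) (prods G) → sgSize G ≤ SN G + length (prods G) * k
sgSize-bound G k short = +-monoʳ-≤ (SN G) (sum-map-bound _ k short)

-- A scored grammar in which every nonterminal X scores the edit distance to
-- a decidable language L X is 1-BD, since appending or prepending a letter
-- is a step that can be undone.
oneBD-from-distance : {T : Set} (letters : List T) → (∀ x → x ∈ letters) → ∀ b
  (G′ : ScoredGrammar T) (L : Fin (SN G′) → List T → Set) → (∀ X τ → Dec (L X τ)) →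
  (∀ X σ d → HasScore G′ X σ d ⇔ IsDist (Step b) (L X) σ d) → OneBD G′
oneBD-from-distance letters letters-complete b G′ L L? score⇔dist X x σ _ =
  close (append-step b σ x) (unappend-step b σ x) , close (insertion b [] σ x) (deletion b [] σ x)
  where
  open Reachability letters letters-complete using (reach?)
  lipschitz = Distance.distance-lipschitz (Step b) (L X) (reach? (L? X) b)
  close : ∀ {σ τ} → Step b σ τ → Step b τ σ → Close G′ X σ τ
  close {σ} {τ} σ→τ τ→σ =
    (λ d hs → let (e , dist , d≤ , e≤) = lipschitz σ→τ τ→σ (Equivalence.to (score⇔dist X σ d) hs)
              in e , Equivalence.from (score⇔dist X τ e) dist , d≤ , e≤) ,
    (λ e hs → let (d , dist , e≤ , d≤) = lipschitz τ→σ σ→τ (Equivalence.to (score⇔dist X τ e) hs)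
              in d , Equivalence.from (score⇔dist X σ d) dist , d≤ , e≤)

module CNFDecidable {t : ℕ} (G : CNF (Fin t)) where

  open import Data.List.Membership.DecPropositional (≡-dec (_≟ᶠ_ {N G}) (_≟ᶠ_ {t})) using (_∈?_)

  derives-ε : ∀ {Y w} → CNFGen G Y w → w ≡ [] → Y ≡ start G × startEps G ≡ true
  derives-ε (gen-term m) ()
  derives-ε (gen-bin {σ = σ} {τ = τ} m d₁ d₂) eq with derives-ε d₁ (++-conicalˡ σ τ eq)
  ... | X≡S , _ = ⊥-elim (proj₁ (lookupAll (binNonStart G) m) X≡S)
  derives-ε (gen-eps e) refl = refl , e

  ε? : ∀ Z → Dec (CNFGen G Z [])
  ε? Z with Z ≟ᶠ start G | startEps G ≟ᵇ true
  ... | yes refl | yes e = yes (gen-eps e)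
  ... | no Z≢S | _ = no λ d → Z≢S (proj₁ (derives-ε d refl))
  ... | _ | no ¬e = no λ d → ¬e (proj₂ (derives-ε d refl))

  nonempty : ∀ {Y w} → Y ≢ start G → CNFGen G Y w → w ≢ []
  nonempty Y≢S d w≡[] = Y≢S (proj₁ (derives-ε d w≡[]))

  -- CYK-style decision procedure, by recursion on a length bound: a
  -- nonempty word is derived by a terminal rule or by a binary rule whose
  -- halves derive strictly shorter words.
  derives? : ∀ n Z τ → length τ ≤ n → Dec (CNFGen G Z τ)
  derives? n Z [] _ = ε? Z
  derives? zero Z (x ∷ τ) ()
  derives? (suc n) Z (x ∷ τ) (s≤s τ≤n) =
    map′ sound (λ d → complete d refl) ((unit? τ) ⊎-dec any? binary? (binRules G))
    where
    Short : Fin (N G) → List (Fin t) → Set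
    Short X u = length u ≤ n × CNFGen G X u

    short? : ∀ X u → Dec (Short X u)
    short? X u with length u ≤? n
    ... | no u≰n = no λ s → u≰n (proj₁ s)
    ... | yes u≤n = map′ (u≤n ,_) proj₂ (derives? n X u u≤n)

    Unit : List (Fin t) → Set
    Unit τ = τ ≡ [] × (Z , x) ∈ termRules G

    unit? : ∀ τ → Dec (Unit τ)
    unit? [] = map′ (refl ,_) proj₂ ((Z , x) ∈? termRules G)
    unit? (_ ∷ _) = no λ ()

    Binary : Fin (N G) × Fin (N G) × Fin (N G) → Set
    Binary (Z′ , X , Y) = Z′ ≡ Z × Any (λ uv → Short X (proj₁ uv) × Short Y (proj₂ uv)) (cuts (x ∷ τ))

    binary? : ∀ r → Dec (Binary r)
    binary? (Z′ , X , Y) =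
      (Z′ ≟ᶠ Z) ×-dec any? (λ uv → short? X (proj₁ uv) ×-dec short? Y (proj₂ uv)) (cuts (x ∷ τ))

    sound : Unit τ ⊎ Any Binary (binRules G) → CNFGen G Z (x ∷ τ)
    sound (inj₁ (refl , m)) = gen-term m
    sound (inj₂ a) with find a
    ... | (_ , X , Y) , m , refl , a′ with find a′
    ...   | (u , v) , uv∈ , (_ , du) , (_ , dv) =
      subst (CNFGen G Z) (cuts-sound (x ∷ τ) uv∈) (gen-bin m du dv)

    complete : ∀ {w} → CNFGen G Z w → w ≡ x ∷ τ → Unit τ ⊎ Any Binary (binRules G)
    complete (gen-term m) refl = inj₁ (refl , m)
    complete (gen-bin {X = X} {Y = Y} {σ = σ} {τ = τ′} m d₁ d₂) eq with lookupAll (binNonStart G) m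
    ... | X≢S , Y≢S = inj₂ (lose m (refl , halves σ τ′ eq (nonempty X≢S d₁) (nonempty Y≢S d₂) d₁ d₂))
      where
      halves : ∀ σ τ′ → σ ++ τ′ ≡ x ∷ τ → σ ≢ [] → τ′ ≢ [] → CNFGen G X σ → CNFGen G Y τ′ →
               Any (λ uv → Short X (proj₁ uv) × Short Y (proj₂ uv)) (cuts (x ∷ τ))
      halves [] _ _ σ≢[] _ _ _ = ⊥-elim (σ≢[] refl)
      halves (_ ∷ _) [] _ _ τ′≢[] _ _ = ⊥-elim (τ′≢[] refl)
      halves (a ∷ σ′) (b ∷ τ″) eq _ _ d₁ d₂ =
        lose (subst (λ w → (a ∷ σ′ , b ∷ τ″) ∈ cuts w) eq (cuts-complete (a ∷ σ′) (b ∷ τ″)))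
             ((fits (left-shorter (a ∷ σ′) b τ″) , d₁) , (fits (right-shorter a σ′ (b ∷ τ″)) , d₂))
        where
        fits : ∀ {k} → k < length (a ∷ σ′ ++ b ∷ τ″) → k ≤ n
        fits k< = ≤-pred (<-≤-trans k< (subst (λ w → length w ≤ suc n) (sym eq) (s≤s τ≤n)))
    complete (gen-eps e) ()

  cnf? : ∀ Z τ → Dec (CNFGen G Z τ)
  cnf? Z τ = derives? (length τ) Z τ ≤-refl

-- Relaxed derivations describe the derivations of the scored grammar built
-- from a CNF grammar G below, together with their scores.
module LanguageEditDistance {t : ℕ} (G : CNF (Fin t)) (b : Bool) where

  T = Fin t
  NT = Fin (N G)

  -- term-del: the letter of a terminal rule is missing from the word;
  -- term-sub: it is replaced by a; extra-left/right: a letter not generated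
  -- by G occurs at the left/right end of the part derived from Z.
  data Relaxed : NT → List T → ℕ → Set where
    bin : ∀ {Z X Y σ τ m n} → (Z , X , Y) ∈ binRules G →
          Relaxed X σ m → Relaxed Y τ n → Relaxed Z (σ ++ τ) (m + n)
    term : ∀ {Z c} → (Z , c) ∈ termRules G → Relaxed Z [ c ] 0
    eps : startEps G ≡ true → Relaxed (start G) [] 0
    term-del : ∀ {Z c} → (Z , c) ∈ termRules G → Relaxed Z [] 1
    term-sub : ∀ {Z c} → b ≡ true → (Z , c) ∈ termRules G → ∀ a → Relaxed Z [ a ] 1
    extra-left : ∀ {Z σ s} a → Relaxed Z σ s → Relaxed Z (a ∷ σ) (suc s)
    extra-right : ∀ {Z σ s} a → Relaxed Z σ s → Relaxed Z (σ ∷ʳ a) (suc s)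

  Within : NT → List T → ℕ → Set
  Within Z σ n = ∃ λ s → s ≤ n × Relaxed Z σ s

  exact : ∀ {Z τ} → CNFGen G Z τ → Relaxed Z τ 0
  exact (gen-term m) = term m
  exact (gen-bin m d₁ d₂) = bin m (exact d₁) (exact d₂)
  exact (gen-eps e) = eps e

  -- Reading off an edit script: every error rule is one edit step.
  to-script : ∀ {Z σ s} → Relaxed Z σ s →
              ∃ λ τ → ∃ λ n → CNFGen G Z τ × Steps (Step b) σ τ n × n ≤ s
  to-script (bin {σ = σ₁} {τ = σ₂} m d₁ d₂) with to-script d₁ | to-script d₂
  ... | τ₁ , n₁ , g₁ , p₁ , le₁ | τ₂ , n₂ , g₂ , p₂ , le₂ =
    τ₁ ++ τ₂ , n₁ + n₂ , gen-bin m g₁ g₂ ,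
    steps-map (_++ σ₂) (step-ctxʳ b σ₂) p₁ ▸ steps-map (τ₁ ++_) (step-ctxˡ b τ₁) p₂ , +-mono-≤ le₁ le₂
  to-script (term m) = _ , 0 , gen-term m , done , z≤n
  to-script (eps e) = [] , 0 , gen-eps e , done , z≤n
  to-script (term-del {c = c} m) = [ c ] , 1 , gen-term m , step (insertion b [] [] c) done , ≤-refl
  to-script (term-sub {c = c} refl m a) = [ c ] , 1 , gen-term m , step (sub [] [] a c) done , ≤-refl
  to-script (extra-left {σ = σ} a d) with to-script d
  ... | τ , n , g , p , le = τ , suc n , g , step (deletion b [] σ a) p , s≤s le
  to-script (extra-right {σ = σ} a d) with to-script d
  ... | τ , n , g , p , le = τ , suc n , g , step (unappend-step b σ a) p , s≤s le

  bin-left : ∀ {Z X Y σ τ m n} → (Z , X , Y) ∈ binRules G →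
             Within X σ (suc m) → Relaxed Y τ n → Within Z (σ ++ τ) (suc (m + n))
  bin-left {n = n} r (s , s≤ , d₁) d₂ = s + n , +-monoˡ-≤ n s≤ , bin r d₁ d₂

  bin-right : ∀ {Z X Y σ τ m n} → (Z , X , Y) ∈ binRules G →
              Relaxed X σ m → Within Y τ (suc n) → Within Z (σ ++ τ) (suc (m + n))
  bin-right {m = m} {n} r d₁ (s , s≤ , d₂) =
    m + s , ≤-trans (+-monoʳ-≤ m s≤) (≤-reflexive (+-suc m n)) , bin r d₁ d₂

  left-within : ∀ {Z σ s} a → Within Z σ (suc s) → Within Z (a ∷ σ) (suc (suc s))
  left-within a (s′ , s′≤ , d) = suc s′ , s≤s s′≤ , extra-left a d

  right-within : ∀ {Z σ s} a → Within Z σ (suc s) → Within Z (σ ∷ʳ a) (suc (suc s))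
  right-within a (s′ , s′≤ , d) = suc s′ , s≤s s′≤ , extra-right a d

  cast : ∀ {Z σ σ′ n} → σ ≡ σ′ → Within Z σ n → Within Z σ′ n
  cast {Z} {n = n} = subst (λ w → Within Z w n)

  drop-letter : ∀ {Z w s} → Relaxed Z w s → ∀ u c v → w ≡ u ++ c ∷ v → Within Z (u ++ v) (suc s)
  drop-letter (bin {σ = σ} {τ = τ} r d₁ d₂) u c v eq with ++-letter σ τ u c v eq
  ... | inj₁ (v′ , refl , refl) = cast (++-assoc u v′ τ) (bin-left r (drop-letter d₁ u c v′ refl) d₂)
  ... | inj₂ (u′ , refl , refl) = cast (sym (++-assoc σ u′ v)) (bin-right r d₁ (drop-letter d₂ u′ c v refl))
  drop-letter (term r) [] c [] refl = 1 , ≤-refl , term-del r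
  drop-letter (term r) (_ ∷ u) c v eq = ⊥-elim ([]≢++∷ u c v (proj₂ (∷-injective eq)))
  drop-letter (term-sub _ r a) [] c [] refl = 1 , n≤1+n 1 , term-del r
  drop-letter (term-sub _ r a) (_ ∷ u) c v eq = ⊥-elim ([]≢++∷ u c v (proj₂ (∷-injective eq)))
  drop-letter (eps _) u c v eq = ⊥-elim ([]≢++∷ u c v eq)
  drop-letter (term-del _) u c v eq = ⊥-elim ([]≢++∷ u c v eq)
  drop-letter (extra-left {s = s} a d) [] c v refl = s , m≤n⇒m≤1+n (n≤1+n s) , d
  drop-letter (extra-left a d) (_ ∷ u) c v eq with ∷-injective eq
  ... | refl , eq′ = left-within a (drop-letter d u c v eq′)
  drop-letter (extra-right {σ = σ} {s = s} a d) u c v eq with ++-letter σ [ a ] u c v eq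
  ... | inj₁ (v′ , refl , refl) = cast (++-assoc u v′ [ a ]) (right-within a (drop-letter d u c v′ refl))
  ... | inj₂ ([] , refl , refl) =
    cast (sym (trans (++-identityʳ (σ ++ [])) (++-identityʳ σ))) (s , m≤n⇒m≤1+n (n≤1+n s) , d)
  ... | inj₂ (_ ∷ u′ , eq′ , _) = ⊥-elim ([]≢++∷ u′ c v (proj₂ (∷-injective eq′)))

  add-letter : ∀ {Z w s} → Relaxed Z w s → ∀ u c v → w ≡ u ++ v → Within Z (u ++ c ∷ v) (suc s)
  add-letter d [] c v refl = _ , ≤-refl , extra-left c d
  add-letter d u@(_ ∷ _) c [] eq =
    _ , ≤-refl , subst (λ w → Relaxed _ (w ∷ʳ c) _) (trans eq (++-identityʳ u)) (extra-right c d)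
  add-letter (bin {σ = σ} {τ = τ} r d₁ d₂) u@(_ ∷ _) c v@(_ ∷ _) eq with ++-cut σ τ u v eq
  ... | inj₁ (m , u≡σm , refl) =
    cast (trans (sym (++-assoc σ m (c ∷ v))) (cong (_++ c ∷ v) (sym u≡σm)))
         (bin-right r d₁ (add-letter d₂ m c v refl))
  ... | inj₂ (m , refl , v≡mτ) =
    cast (trans (++-assoc u (c ∷ m) τ) (cong (λ z → u ++ c ∷ z) (sym v≡mτ)))
         (bin-left r (add-letter d₁ u c m refl) d₂)
  add-letter (term _) (_ ∷ u) c (y ∷ v) eq = ⊥-elim ([]≢++∷ u y v (proj₂ (∷-injective eq)))
  add-letter (term-sub _ _ _) (_ ∷ u) c (y ∷ v) eq = ⊥-elim ([]≢++∷ u y v (proj₂ (∷-injective eq)))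
  add-letter (eps _) (_ ∷ _) c (_ ∷ _) ()
  add-letter (term-del _) (_ ∷ _) c (_ ∷ _) ()
  add-letter (extra-left a d) (_ ∷ u) c v@(_ ∷ _) eq with ∷-injective eq
  ... | refl , eq′ = left-within a (add-letter d u c v eq′)
  add-letter (extra-right {σ = σ} a d) u@(_ ∷ _) c v@(y ∷ v′) eq with ++-cut σ [ a ] u v eq
  ... | inj₁ ([] , u≡σ[] , refl) =
    cast (trans (++-assoc σ [ c ] [ a ]) (cong (_++ c ∷ a ∷ []) (trans (sym (++-identityʳ σ)) (sym u≡σ[]))))
         (right-within a (add-letter d σ c [] (sym (++-identityʳ σ))))
  ... | inj₁ (_ ∷ m , _ , eq′) = ⊥-elim ([]≢++∷ m y v′ (proj₂ (∷-injective eq′)))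
  ... | inj₂ (m , refl , v≡m[a]) =
    cast (trans (++-assoc u (c ∷ m) [ a ]) (cong (λ z → u ++ c ∷ z) (sym v≡m[a])))
         (right-within a (add-letter d u c m refl))

  change-letter : b ≡ true → ∀ {Z w s} → Relaxed Z w s → ∀ u c c′ v → w ≡ u ++ c ∷ v →
                  Within Z (u ++ c′ ∷ v) (suc s)
  change-letter b≡t (bin {σ = σ} {τ = τ} r d₁ d₂) u c c′ v eq with ++-letter σ τ u c v eq
  ... | inj₁ (v′ , refl , refl) =
    cast (++-assoc u (c′ ∷ v′) τ) (bin-left r (change-letter b≡t d₁ u c c′ v′ refl) d₂)
  ... | inj₂ (u′ , refl , refl) =
    cast (sym (++-assoc σ u′ (c′ ∷ v))) (bin-right r d₁ (change-letter b≡t d₂ u′ c c′ v refl))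
  change-letter b≡t (term r) [] c c′ [] refl = 1 , ≤-refl , term-sub b≡t r c′
  change-letter b≡t (term r) (_ ∷ u) c c′ v eq = ⊥-elim ([]≢++∷ u c v (proj₂ (∷-injective eq)))
  change-letter b≡t (term-sub _ r a) [] c c′ [] refl = 1 , n≤1+n 1 , term-sub b≡t r c′
  change-letter b≡t (term-sub _ r a) (_ ∷ u) c c′ v eq = ⊥-elim ([]≢++∷ u c v (proj₂ (∷-injective eq)))
  change-letter b≡t (eps _) u c c′ v eq = ⊥-elim ([]≢++∷ u c v eq)
  change-letter b≡t (term-del _) u c c′ v eq = ⊥-elim ([]≢++∷ u c v eq)
  change-letter b≡t (extra-left {s = s} a d) [] c c′ v refl = suc s , n≤1+n _ , extra-left c′ d
  change-letter b≡t (extra-left a d) (_ ∷ u) c c′ v eq with ∷-injective eq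
  ... | refl , eq′ = left-within a (change-letter b≡t d u c c′ v eq′)
  change-letter b≡t (extra-right {σ = σ} {s = s} a d) u c c′ v eq with ++-letter σ [ a ] u c v eq
  ... | inj₁ (v′ , refl , refl) =
    cast (++-assoc u (c′ ∷ v′) [ a ]) (right-within a (change-letter b≡t d u c c′ v′ refl))
  ... | inj₂ ([] , refl , refl) = cast (cong (_∷ʳ c′) (sym (++-identityʳ σ))) (suc s , n≤1+n _ , extra-right c′ d)
  ... | inj₂ (_ ∷ u′ , eq′ , _) = ⊥-elim ([]≢++∷ u′ c v (proj₂ (∷-injective eq′)))

  undo-step : ∀ {Z σ ρ n} → Step b σ ρ → Within Z ρ n → Within Z σ (suc n)
  undo-step = undo b refl
    where
    undo : ∀ b′ → b′ ≡ b → ∀ {Z σ ρ n} → Step b′ σ ρ → Within Z ρ n → Within Z σ (suc n)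
    undo true _ (ins u v c) (_ , k≤n , d) = within-mono k≤n (drop-letter d u c v refl)
    undo true _ (del u v c) (_ , k≤n , d) = within-mono k≤n (add-letter d u c v refl)
    undo true b≡ (sub u v c c′) (_ , k≤n , d) = within-mono k≤n (change-letter (sym b≡) d u c′ c v refl)
    undo false _ (ins u v c) (_ , k≤n , d) = within-mono k≤n (drop-letter d u c v refl)
    undo false _ (del u v c) (_ , k≤n , d) = within-mono k≤n (add-letter d u c v refl)

  from-script : ∀ {Z σ τ n} → CNFGen G Z τ → Steps (Step b) σ τ n → Within Z σ n
  from-script g done = 0 , z≤n , exact g
  from-script g (step s p) = undo-step s (from-script g p)

  -- The scored grammar G′ itself; Rule describes its productions, which are
  -- enumerated in the list productions.
  Production : Set
  Production = NT × List (NT ⊎ T) × ℕ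

  data Rule : Production → Set where
    binary : ∀ {Z X Y} → (Z , X , Y) ∈ binRules G → Rule (Z , inj₁ X ∷ inj₁ Y ∷ [] , 0)
    terminal : ∀ {Z c} → (Z , c) ∈ termRules G → Rule (Z , inj₂ c ∷ [] , 0)
    empty : startEps G ≡ true → Rule (start G , [] , 0)
    deleted : ∀ {Z c} → (Z , c) ∈ termRules G → Rule (Z , [] , 1)
    substituted : ∀ {Z c} → b ≡ true → (Z , c) ∈ termRules G → ∀ a → Rule (Z , inj₂ a ∷ [] , 1)
    inserted-left : ∀ Z a → Rule (Z , inj₂ a ∷ inj₁ Z ∷ [] , 1)
    inserted-right : ∀ Z a → Rule (Z , inj₁ Z ∷ inj₂ a ∷ [] , 1)

  binary-rule : NT × NT × NT → Production
  binary-rule (Z , X , Y) = Z , inj₁ X ∷ inj₁ Y ∷ [] , 0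

  terminal-rule : NT × T → Production
  terminal-rule (Z , c) = Z , inj₂ c ∷ [] , 0

  deletion-rule : NT × T → Production
  deletion-rule (Z , _) = Z , [] , 1

  substitution-rules : NT × T → List Production
  substitution-rules (Z , _) = map (λ a → Z , inj₂ a ∷ [] , 1) (allFin t)

  insertion-pair : NT → T → List Production
  insertion-pair Z a = (Z , inj₂ a ∷ inj₁ Z ∷ [] , 1) ∷ (Z , inj₁ Z ∷ inj₂ a ∷ [] , 1) ∷ []

  insertion-rules : NT → List Production
  insertion-rules Z = concatMap (insertion-pair Z) (allFin t)

  when : Bool → List Production → List Production
  when true ps = ps
  when false _ = []

  ε-rule : List Production
  ε-rule = [ (start G , [] , 0) ]

  binaries terminals deletions substitutions insertions error-rules productions : List Production
  binaries = map binary-rule (binRules G)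
  terminals = map terminal-rule (termRules G)
  deletions = map deletion-rule (termRules G)
  substitutions = concatMap substitution-rules (termRules G)
  insertions = concatMap insertion-rules (allFin (N G))
  error-rules = deletions ++ when b substitutions ++ insertions
  productions = binaries ++ terminals ++ when (startEps G) ε-rule ++ error-rules

  G′ : ScoredGrammar T
  G′ = record { SN = N G ; sstart = start G ; prods = productions }

  rule-sound : ∀ {p} → p ∈ productions → Rule p
  rule-sound =
    ∈-++-elim _ (∈-map-elim binary-rule binary) (∈-++-elim _ (∈-map-elim terminal-rule terminal)
      (∈-++-elim _ (eps-sound (startEps G) refl) (∈-++-elim _ (∈-map-elim deletion-rule deleted)
        (∈-++-elim _ (sub-sound b refl) (∈-concatMap-elim insertion-rules ins-sound)))))
    where
    open ∈-Elim Rule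
    eps-sound : ∀ e → e ≡ startEps G → ∀ {p} → p ∈ when e ε-rule → Rule p
    eps-sound true e (here refl) = empty (sym e)
    sub-sound : ∀ b′ → b′ ≡ b → ∀ {p} → p ∈ when b′ substitutions → Rule p
    sub-sound true b≡ = ∈-concatMap-elim substitution-rules λ r → ∈-map-elim _ λ {a} _ → substituted (sym b≡) r a
    ins-sound : ∀ {Z p} → Z ∈ allFin (N G) → p ∈ insertion-rules Z → Rule p
    ins-sound {Z} _ = ∈-concatMap-elim (insertion-pair Z) {xs = allFin t}
      λ { {a} _ (here refl) → inserted-left Z a ; {a} _ (there (here refl)) → inserted-right Z a }

  private
    error-rule : ∀ {p} → p ∈ error-rules → p ∈ productions
    error-rule m = ∈-++⁺ʳ binaries (∈-++⁺ʳ terminals (∈-++⁺ʳ (when (startEps G) ε-rule) m))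
    insertion-rule-∈ : ∀ Z a {p} → p ∈ insertion-pair Z a →
                p ∈ insertions
    insertion-rule-∈ Z a m =
      ∈-concatMap⁺ insertion-rules (lose (∈-allFin Z) (∈-concatMap⁺ (insertion-pair Z) (lose (∈-allFin a) m)))

  rule-complete : ∀ {p} → Rule p → p ∈ productions
  rule-complete (binary r) = ∈-++⁺ˡ (∈-map⁺ binary-rule r)
  rule-complete (terminal r) = ∈-++⁺ʳ binaries (∈-++⁺ˡ (∈-map⁺ terminal-rule r))
  rule-complete (empty e) =
    ∈-++⁺ʳ binaries (∈-++⁺ʳ terminals (∈-++⁺ˡ (subst (λ e′ → _ ∈ when e′ ε-rule) (sym e) (here refl))))
  rule-complete (deleted r) = error-rule (∈-++⁺ˡ (∈-map⁺ deletion-rule r))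
  rule-complete (substituted b≡t r a) =
    error-rule (∈-++⁺ʳ deletions (∈-++⁺ˡ (subst (λ b′ → _ ∈ when b′ substitutions) (sym b≡t)
      (∈-concatMap⁺ substitution-rules (lose r (∈-map⁺ _ (∈-allFin a)))))))
  rule-complete (inserted-left Z a) =
    error-rule (∈-++⁺ʳ deletions (∈-++⁺ʳ (when b substitutions) (insertion-rule-∈ Z a (here refl))))
  rule-complete (inserted-right Z a) =
    error-rule (∈-++⁺ʳ deletions (∈-++⁺ʳ (when b substitutions) (insertion-rule-∈ Z a (there (here refl)))))

  relaxed-cast : ∀ {Z σ σ′ s s′} → σ ≡ σ′ → s ≡ s′ → Relaxed Z σ s → Relaxed Z σ′ s′
  relaxed-cast refl refl d = d

  derivation-cast : ∀ {Z σ σ′ s s′} → σ ≡ σ′ → s ≡ s′ → SDerives G′ Z σ s → SDerives G′ Z σ′ s′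
  derivation-cast refl refl d = d

  mutual
    relaxed : ∀ {Z σ s} → SDerives G′ Z σ s → Relaxed Z σ s
    relaxed (sder p∈ seq) = apply-rule (rule-sound p∈) seq

    apply-rule : ∀ {Z rhs w σ c} → Rule (Z , rhs , w) → SDerivesSeq G′ rhs σ c → Relaxed Z σ (w + c)
    apply-rule (binary r) (snt {σ = σ₁} d₁ (snt {σ = σ₂} {c = c₂} d₂ snil)) =
      relaxed-cast (cong (σ₁ ++_) (sym (++-identityʳ σ₂))) (cong (_ +_) (sym (+-identityʳ c₂)))
        (bin r (relaxed d₁) (relaxed d₂))
    apply-rule (terminal r) (sterm snil) = term r
    apply-rule (empty e) snil = eps e
    apply-rule (deleted r) snil = term-del r
    apply-rule (substituted b≡t r a) (sterm snil) = term-sub b≡t r a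
    apply-rule (inserted-left Z a) (sterm (snt {σ = σ} {c = c} d snil)) =
      relaxed-cast (cong (a ∷_) (sym (++-identityʳ σ))) (cong suc (sym (+-identityʳ c))) (extra-left a (relaxed d))
    apply-rule (inserted-right Z a) (snt {c = c} d (sterm snil)) =
      relaxed-cast refl (cong suc (sym (+-identityʳ c))) (extra-right a (relaxed d))

  derivation : ∀ {Z σ s} → Relaxed Z σ s → SDerives G′ Z σ s
  derivation (bin {σ = σ} {τ = τ} {m = m} {n = n} r d₁ d₂) =
    derivation-cast (cong (σ ++_) (++-identityʳ τ)) (cong (m +_) (+-identityʳ n))
      (sder (rule-complete (binary r)) (snt (derivation d₁) (snt (derivation d₂) snil)))
  derivation (term r) = sder (rule-complete (terminal r)) (sterm snil)
  derivation (eps e) = sder (rule-complete (empty e)) snil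
  derivation (term-del r) = sder (rule-complete (deleted r)) snil
  derivation (term-sub b≡t r a) = sder (rule-complete (substituted b≡t r a)) (sterm snil)
  derivation (extra-left {Z = Z} {σ = σ} {s = s} a d) =
    derivation-cast (cong (a ∷_) (++-identityʳ σ)) (cong suc (+-identityʳ s))
      (sder (rule-complete (inserted-left Z a)) (sterm (snt (derivation d) snil)))
  derivation (extra-right {Z = Z} {s = s} a d) =
    derivation-cast refl (cong suc (+-identityʳ s))
      (sder (rule-complete (inserted-right Z a)) (snt (derivation d) (sterm snil)))

  score⇔distance : ∀ Z σ d → HasScore G′ Z σ d ⇔ IsDist (Step b) (CNFGen G Z) σ d
  score⇔distance Z = Distance.minimal-score⇔distance (Step b) (CNFGen G Z) (SDerives G′ Z)
    (λ d → to-script (relaxed d)) (λ g p → let (s , s≤n , d) = from-script g p in s , s≤n , derivation d)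

  oneBD : OneBD G′
  oneBD = oneBD-from-distance (allFin t) ∈-allFin b G′ (CNFGen G) (CNFDecidable.cnf? G) score⇔distance

  -- Size: right-hand sides have length at most 2, and there are O(|G|²)
  -- productions, the insertion rules Z → a Z, Z → Z a being the most numerous.
  rhs-short : ∀ {p} → Rule p → suc (length (proj₁ (proj₂ p))) ≤ 3
  rhs-short (binary _) = ≤-refl
  rhs-short (terminal _) = s≤s (s≤s z≤n)
  rhs-short (empty _) = s≤s z≤n
  rhs-short (deleted _) = s≤s z≤n
  rhs-short (substituted _ _ _) = s≤s (s≤s z≤n)
  rhs-short (inserted-left _ _) = ≤-refl
  rhs-short (inserted-right _ _) = ≤-refl

  length-when : ∀ e (ps : List Production) → length (when e ps) ≤ length ps
  length-when true ps = ≤-refl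
  length-when false ps = z≤n

  #bin = length (binRules G)
  #term = length (termRules G)

  production-count : length productions ≤ #bin + (#term + (1 + (#term + (#term * t + N G * (t * 2)))))
  production-count =
    length-++-mono binaries _ (≤-reflexive (length-map binary-rule (binRules G)))
    (length-++-mono terminals _ (≤-reflexive (length-map terminal-rule (termRules G)))
    (length-++-mono (when (startEps G) ε-rule) _ (length-when (startEps G) ε-rule)
    (length-++-mono deletions _ (≤-reflexive (length-map deletion-rule (termRules G)))
    (length-++-mono (when b substitutions) insertions
                    (≤-trans (length-when b substitutions) (≤-reflexive #substitutions))
                    (≤-reflexive #insertions)))))
    where
    #substitutions : length substitutions ≡ #term * t
    #substitutions = length-concatMap substitution-rules t (λ _ → length-map-allFin _) (termRules G)
    #insertions : length insertions ≡ N G * (t * 2)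
    #insertions = trans (length-concatMap insertion-rules (t * 2) #rules (allFin (N G)))
                        (cong (_* (t * 2)) (length-allFin (N G)))
      where
      #rules : ∀ Z → length (insertion-rules Z) ≡ t * 2
      #rules Z = trans (length-concatMap (insertion-pair Z) 2 (λ _ → refl) (allFin t)) (cong (_* 2) (length-allFin t))

  -- Every parameter of G is at most S = |G|, which gives |G′| ≤ 22 |G|².
  size : sgSize G′ ≤ 22 * cnfSize G ^ 2
  size = begin
    sgSize G′
      ≤⟨ sgSize-bound G′ 3 (All.tabulate (λ p∈ → rhs-short (rule-sound p∈))) ⟩
    N G + length productions * 3
      ≤⟨ +-monoʳ-≤ (N G) (*-monoˡ-≤ 3 production-count) ⟩
    N G + (#bin + (#term + (1 + (#term + (#term * t + N G * (t * 2)))))) * 3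
      ≤⟨ +-mono-≤ N≤S (*-monoˡ-≤ 3 (+-mono-≤ #bin≤S (+-mono-≤ #term≤S (+-mono-≤ 1≤S (+-mono-≤ #term≤S
           (+-mono-≤ (*-mono-≤ #term≤S t≤S) (*-mono-≤ N≤S (*-monoˡ-≤ 2 t≤S)))))))) ⟩
    S + (S + (S + (S + (S + (S * S + S * (S * 2)))))) * 3
      ≡⟨ expand S ⟩
    13 * S + 9 * (S * S)
      ≤⟨ +-monoˡ-≤ (9 * (S * S)) (*-monoʳ-≤ 13 S≤S²) ⟩
    13 * (S * S) + 9 * (S * S)
      ≡⟨ collect S ⟩
    22 * S ^ 2
      ∎
    where
    open ≤-Reasoning
    S = cnfSize G
    t≤S : t ≤ S
    t≤S = m≤n⇒m≤n+o 1 (m≤n⇒m≤n+o #term (m≤n⇒m≤n+o #bin (m≤m+n t (N G))))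
    N≤S : N G ≤ S
    N≤S = m≤n⇒m≤n+o 1 (m≤n⇒m≤n+o #term (m≤n⇒m≤n+o #bin (m≤n+m (N G) t)))
    #bin≤S : #bin ≤ S
    #bin≤S = m≤n⇒m≤n+o 1 (m≤n⇒m≤n+o #term (m≤n+m #bin (t + N G)))
    #term≤S : #term ≤ S
    #term≤S = m≤n⇒m≤n+o 1 (m≤n+m #term (t + N G + #bin))
    1≤S : 1 ≤ S
    1≤S = m≤n+m 1 (t + N G + #bin + #term)
    S≤S² : S ≤ S * S
    S≤S² = ≤-trans (≤-reflexive (sym (*-identityʳ S))) (*-monoʳ-≤ S 1≤S)
    expand : ∀ x → x + (x + (x + (x + (x + (x * x + x * (x * 2)))))) * 3 ≡ 13 * x + 9 * (x * x)
    expand = solve-∀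
    collect : ∀ x → 13 * (x * x) + 9 * (x * x) ≡ 22 * (x * (x * 1))
    collect = solve-∀

-- Relaxed derivations describe the derivations of the scored
-- grammar  S → S S | ε | c S c′ | c′ S c  (score 0) and  S → a S  (score 1),
-- where the last rule leaves the letter a unpaired.
module RNA (m : ℕ) where

  C = RNAChar m

  -- A relaxed derivation pairs letters in a nested way and leaves the
  -- remaining letters unpaired, each at cost one.
  data Relaxed : List C → ℕ → Set where
    cat : ∀ {σ τ k l} → Relaxed σ k → Relaxed τ l → Relaxed (σ ++ τ) (k + l)
    none : Relaxed [] 0
    unpaired : ∀ {σ s} x → Relaxed σ s → Relaxed (x ∷ σ) (suc s)
    pair : ∀ {σ s x y} → Matches x y → Relaxed σ s → Relaxed (x ∷ σ ++ [ y ]) s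

  Within : List C → ℕ → Set
  Within σ n = ∃ λ s → s ≤ n × Relaxed σ s

  cast : ∀ {σ σ′ n} → σ ≡ σ′ → Within σ n → Within σ′ n
  cast {n = n} = subst (λ w → Within w n)

  paired : ∀ {x y : C} {σ} → Matches x y → RNALang σ → RNALang (x ∷ σ ++ [ y ])
  paired (_ , inj₁ (refl , refl)) l = r-pair l
  paired (_ , inj₂ (refl , refl)) l = r-pair' l

  exact : ∀ {τ : List C} → RNALang τ → Relaxed τ 0
  exact r-eps = none
  exact (r-cat l₁ l₂) = cat (exact l₁) (exact l₂)
  exact (r-pair l) = pair (_ , inj₁ (refl , refl)) (exact l)
  exact (r-pair' l) = pair (_ , inj₂ (refl , refl)) (exact l)

  -- Every unpaired letter is deleted by the corresponding edit script.
  to-script : ∀ {σ s} → Relaxed σ s → ∃ λ τ → ∃ λ n → RNALang τ × Steps IndelStep σ τ n × n ≤ s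
  to-script (cat {σ = σ₁} {τ = σ₂} d₁ d₂) with to-script d₁ | to-script d₂
  ... | τ₁ , n₁ , l₁ , p₁ , le₁ | τ₂ , n₂ , l₂ , p₂ , le₂ =
    τ₁ ++ τ₂ , n₁ + n₂ , r-cat l₁ l₂ ,
    steps-map (_++ σ₂) (step-ctxʳ false σ₂) p₁ ▸ steps-map (τ₁ ++_) (step-ctxˡ false τ₁) p₂ ,
    +-mono-≤ le₁ le₂
  to-script none = [] , 0 , r-eps , done , z≤n
  to-script (unpaired {σ = σ} x d) with to-script d
  ... | τ , n , l , p , le = τ , suc n , l , step (del [] σ x) p , s≤s le
  to-script (pair {x = x} {y = y} xy d) with to-script d
  ... | τ , n , l , p , le =
    x ∷ τ ++ [ y ] , n , paired xy l ,
    steps-map (λ w → x ∷ w ++ [ y ]) (λ r → step-ctxˡ false [ x ] (step-ctxʳ false [ y ] r)) p , le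

  cat-left : ∀ {σ τ k l} → Within σ (suc k) → Relaxed τ l → Within (σ ++ τ) (suc (k + l))
  cat-left {l = l} (s , s≤ , d₁) d₂ = s + l , +-monoˡ-≤ l s≤ , cat d₁ d₂

  cat-right : ∀ {σ τ k l} → Relaxed σ k → Within τ (suc l) → Within (σ ++ τ) (suc (k + l))
  cat-right {k = k} {l} d₁ (s , s≤ , d₂) = k + s , ≤-trans (+-monoʳ-≤ k s≤) (≤-reflexive (+-suc k l)) , cat d₁ d₂

  unpaired-within : ∀ {σ s} x → Within σ (suc s) → Within (x ∷ σ) (suc (suc s))
  unpaired-within x (s′ , s′≤ , d) = suc s′ , s≤s s′≤ , unpaired x d

  pair-within : ∀ {σ n x y} → Matches x y → Within σ n → Within (x ∷ σ ++ [ y ]) n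
  pair-within xy (s , s≤ , d) = s , s≤ , pair xy d

  unpaired-end : ∀ {σ s} y → Relaxed σ s → Within (σ ++ [ y ]) (suc s)
  unpaired-end {s = s} y d = s + 1 , ≤-reflexive (+-comm s 1) , cat d (unpaired y none)

  drop-letter : ∀ {w s} → Relaxed w s → ∀ u c v → w ≡ u ++ c ∷ v → Within (u ++ v) (suc s)
  drop-letter (cat {σ = σ} {τ = τ} d₁ d₂) u c v eq with ++-letter σ τ u c v eq
  ... | inj₁ (v′ , refl , refl) = cast (++-assoc u v′ τ) (cat-left (drop-letter d₁ u c v′ refl) d₂)
  ... | inj₂ (u′ , refl , refl) = cast (sym (++-assoc σ u′ v)) (cat-right d₁ (drop-letter d₂ u′ c v refl))
  drop-letter none u c v eq = ⊥-elim ([]≢++∷ u c v eq)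
  drop-letter (unpaired {s = s} x d) [] c v refl = s , m≤n⇒m≤1+n (n≤1+n s) , d
  drop-letter (unpaired x d) (_ ∷ u) c v eq with ∷-injective eq
  ... | refl , eq′ = unpaired-within x (drop-letter d u c v eq′)
  drop-letter (pair {σ = σ} {y = y} xy d) [] c v refl = unpaired-end y d
  drop-letter (pair {σ = σ} {s = s} {x = x} {y = y} xy d) (_ ∷ u) c v eq with ∷-injective eq
  ... | refl , eq′ with ++-letter σ [ y ] u c v eq′
  ...   | inj₁ (v′ , refl , refl) = cast (cong (x ∷_) (++-assoc u v′ [ y ])) (pair-within xy (drop-letter d u c v′ refl))
  ...   | inj₂ ([] , refl , refl) =
    suc s , ≤-refl ,
    subst (λ w → Relaxed (x ∷ w) (suc s)) (sym (trans (++-identityʳ (σ ++ [])) (++-identityʳ σ))) (unpaired x d)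
  ...   | inj₂ (_ ∷ u′ , eq″ , _) = ⊥-elim ([]≢++∷ u′ c v (proj₂ (∷-injective eq″)))

  add-letter : ∀ {w s} → Relaxed w s → ∀ u c v → w ≡ u ++ v → Within (u ++ c ∷ v) (suc s)
  add-letter d [] c v refl = _ , ≤-refl , unpaired c d
  add-letter d u c [] eq = cast (cong (_++ [ c ]) (trans eq (++-identityʳ u))) (unpaired-end c d)
  add-letter (cat {σ = σ} {τ = τ} d₁ d₂) u@(_ ∷ _) c v@(_ ∷ _) eq with ++-cut σ τ u v eq
  ... | inj₁ (k , u≡σk , refl) =
    cast (trans (sym (++-assoc σ k (c ∷ v))) (cong (_++ c ∷ v) (sym u≡σk))) (cat-right d₁ (add-letter d₂ k c v refl))
  ... | inj₂ (k , refl , v≡kτ) =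
    cast (trans (++-assoc u (c ∷ k) τ) (cong (λ z → u ++ c ∷ z) (sym v≡kτ))) (cat-left (add-letter d₁ u c k refl) d₂)
  add-letter none (_ ∷ _) c (_ ∷ _) ()
  add-letter (unpaired x d) (_ ∷ u) c v@(_ ∷ _) eq with ∷-injective eq
  ... | refl , eq′ = unpaired-within x (add-letter d u c v eq′)
  add-letter (pair {σ = σ} {x = x} {y = y} xy d) (_ ∷ u) c (z ∷ v) eq with ∷-injective eq
  ... | refl , eq′ with ++-cut σ [ y ] u (z ∷ v) eq′
  ...   | inj₁ ([] , u≡σ[] , refl) =
    cast (cong (x ∷_) (trans (++-assoc σ [ c ] [ y ])
                        (cong (_++ c ∷ y ∷ []) (trans (sym (++-identityʳ σ)) (sym u≡σ[])))))
         (pair-within xy (add-letter d σ c [] (sym (++-identityʳ σ))))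
  ...   | inj₁ (_ ∷ k , _ , eq″) = ⊥-elim ([]≢++∷ k z v (proj₂ (∷-injective eq″)))
  ...   | inj₂ (k , refl , zv≡ky) =
    cast (cong (x ∷_) (trans (++-assoc u (c ∷ k) [ y ]) (cong (λ w → u ++ c ∷ w) (sym zv≡ky))))
         (pair-within xy (add-letter d u c k refl))

  undo-step : ∀ {σ ρ n} → IndelStep σ ρ → Within ρ n → Within σ (suc n)
  undo-step (ins u v c) (_ , k≤n , d) = within-mono k≤n (drop-letter d u c v refl)
  undo-step (del u v c) (_ , k≤n , d) = within-mono k≤n (add-letter d u c v refl)

  from-script : ∀ {σ τ n} → RNALang τ → Steps IndelStep σ τ n → Within σ n
  from-script l done = 0 , z≤n , exact l
  from-script l (step s p) = undo-step s (from-script l p)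

  matches? : ∀ (x y : C) → Dec (Matches x y)
  matches? (inj₁ c) (inj₂ d) with c ≟ᶠ d
  ... | yes refl = yes (c , inj₁ (refl , refl))
  ... | no c≢d = no λ { (_ , inj₁ (refl , refl)) → c≢d refl ; (_ , inj₂ (() , _)) }
  matches? (inj₂ c) (inj₁ d) with c ≟ᶠ d
  ... | yes refl = yes (c , inj₂ (refl , refl))
  ... | no c≢d = no λ { (_ , inj₁ (() , _)) ; (_ , inj₂ (refl , refl)) → c≢d refl }
  matches? (inj₁ c) (inj₁ d) = no λ { (_ , inj₁ (_ , ())) ; (_ , inj₂ (() , _)) }
  matches? (inj₂ c) (inj₂ d) = no λ { (_ , inj₁ (() , _)) ; (_ , inj₂ (_ , ())) }

  first-paired : ∀ {w : List C} → RNALang w → ∀ {x r} → w ≡ x ∷ r →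
    ∃ λ u → ∃ λ y → ∃ λ v → r ≡ u ++ y ∷ v × Matches x y × RNALang u × RNALang v
  first-paired r-eps ()
  first-paired (r-cat {σ = []} l₁ l₂) eq = first-paired l₂ eq
  first-paired (r-cat {σ = _ ∷ σ} {τ} l₁ l₂) refl with first-paired l₁ refl
  ... | u , y , v , refl , xy , lu , lv = u , y , v ++ τ , ++-assoc u (y ∷ v) τ , xy , lu , r-cat lv l₂
  first-paired (r-pair {c} {σ} l) refl = σ , inj₂ c , [] , refl , (c , inj₁ (refl , refl)) , l , r-eps
  first-paired (r-pair' {c} {σ} l) refl = σ , inj₁ c , [] , refl , (c , inj₂ (refl , refl)) , l , r-eps

  -- Decision procedure by recursion on a length bound: try every partner
  -- of the first letter.
  folds? : ∀ n (w : List C) → length w ≤ n → Dec (RNALang w)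
  folds? n [] _ = yes r-eps
  folds? zero (x ∷ r) ()
  folds? (suc n) (x ∷ r) (s≤s r≤n) = map′ sound complete (any? paired-at? (cuts r))
    where
    Short : List C → Set
    Short u = length u ≤ n × RNALang u

    short? : ∀ u → Dec (Short u)
    short? u with length u ≤? n
    ... | no u≰n = no λ s → u≰n (proj₁ s)
    ... | yes u≤n = map′ (u≤n ,_) proj₂ (folds? n u u≤n)

    PairedAt : List C × List C → Set
    PairedAt (u , []) = ⊥
    PairedAt (u , y ∷ v) = Matches x y × Short u × Short v

    paired-at? : ∀ uv → Dec (PairedAt uv)
    paired-at? (u , []) = no λ ()
    paired-at? (u , y ∷ v) = matches? x y ×-dec short? u ×-dec short? v

    sound : Any PairedAt (cuts r) → RNALang (x ∷ r)
    sound a with find a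
    ... | (u , y ∷ v) , uv∈ , xy , (_ , lu) , (_ , lv) =
      subst (λ w → RNALang (x ∷ w)) (trans (++-assoc u [ y ] v) (cuts-sound r uv∈)) (r-cat (paired xy lu) lv)

    complete : RNALang (x ∷ r) → Any PairedAt (cuts r)
    complete l with first-paired l refl
    ... | u , y , v , r≡ , xy , lu , lv =
      lose (subst (λ w → (u , y ∷ v) ∈ cuts w) (sym r≡) (cuts-complete u (y ∷ v)))
           (xy , (fits (length-++-≤ˡ u) , lu) , (fits (≤-trans (n≤1+n _) (length-++-≤ʳ (y ∷ v) {u})) , lv))
      where
      fits : ∀ {k} → k ≤ length (u ++ y ∷ v) → k ≤ n
      fits k≤ = ≤-trans k≤ (subst (λ w → length w ≤ n) r≡ r≤n)

  rna? : ∀ (w : List C) → Dec (RNALang w)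
  rna? w = folds? (length w) w ≤-refl

  Production : Set
  Production = Fin 1 × List (Fin 1 ⊎ C) × ℕ

  S : Fin 1
  S = zero

  data Rule : Production → Set where
    concatenation : Rule (S , inj₁ S ∷ inj₁ S ∷ [] , 0)
    empty : Rule (S , [] , 0)
    unpaired-rule : ∀ a → Rule (S , inj₂ a ∷ inj₁ S ∷ [] , 1)
    pair-rule : ∀ {x y} → Matches x y → Rule (S , inj₂ x ∷ inj₁ S ∷ inj₂ y ∷ [] , 0)

  letters : List C
  letters = map inj₁ (allFin m) ++ map inj₂ (allFin m)

  letters-complete : ∀ x → x ∈ letters
  letters-complete (inj₁ c) = ∈-++⁺ˡ (∈-map⁺ inj₁ (∈-allFin c))
  letters-complete (inj₂ c) = ∈-++⁺ʳ (map inj₁ (allFin m)) (∈-map⁺ inj₂ (∈-allFin c))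

  unpaired-production : C → Production
  unpaired-production a = S , inj₂ a ∷ inj₁ S ∷ [] , 1

  pair-production pair-production′ : Fin m → Production
  pair-production c = S , inj₂ (inj₁ c) ∷ inj₁ S ∷ inj₂ (inj₂ c) ∷ [] , 0
  pair-production′ c = S , inj₂ (inj₂ c) ∷ inj₁ S ∷ inj₂ (inj₁ c) ∷ [] , 0

  unpaired-productions pair-productions productions : List Production
  unpaired-productions = map unpaired-production letters
  pair-productions = map pair-production (allFin m) ++ map pair-production′ (allFin m)
  productions = (S , inj₁ S ∷ inj₁ S ∷ [] , 0) ∷ (S , [] , 0) ∷ unpaired-productions ++ pair-productions

  G′ : ScoredGrammar C
  G′ = record { SN = 1 ; sstart = S ; prods = productions }

  rule-sound : ∀ {p} → p ∈ productions → Rule p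
  rule-sound (here refl) = concatenation
  rule-sound (there (here refl)) = empty
  rule-sound (there (there p∈)) =
    ∈-++-elim unpaired-productions (∈-map-elim unpaired-production λ {a} _ → unpaired-rule a)
      (∈-++-elim (map pair-production (allFin m))
        (∈-map-elim pair-production λ {c} _ → pair-rule (c , inj₁ (refl , refl)))
        (∈-map-elim pair-production′ λ {c} _ → pair-rule (c , inj₂ (refl , refl)))) p∈
    where open ∈-Elim Rule

  rule-complete : ∀ {p} → Rule p → p ∈ productions
  rule-complete concatenation = here refl
  rule-complete empty = there (here refl)
  rule-complete (unpaired-rule a) = there (there (∈-++⁺ˡ (∈-map⁺ unpaired-production (letters-complete a))))
  rule-complete (pair-rule (c , inj₁ (refl , refl))) =
    there (there (∈-++⁺ʳ unpaired-productions (∈-++⁺ˡ (∈-map⁺ pair-production (∈-allFin c)))))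
  rule-complete (pair-rule (c , inj₂ (refl , refl))) =
    there (there (∈-++⁺ʳ unpaired-productions
      (∈-++⁺ʳ (map pair-production (allFin m)) (∈-map⁺ pair-production′ (∈-allFin c)))))

  relaxed-cast : ∀ {σ σ′ s s′} → σ ≡ σ′ → s ≡ s′ → Relaxed σ s → Relaxed σ′ s′
  relaxed-cast refl refl d = d

  derivation-cast : ∀ {σ σ′ s s′} → σ ≡ σ′ → s ≡ s′ → SDerives G′ S σ s → SDerives G′ S σ′ s′
  derivation-cast refl refl d = d

  mutual
    relaxed : ∀ {X σ s} → SDerives G′ X σ s → Relaxed σ s
    relaxed (sder p∈ seq) = apply-rule (rule-sound p∈) seq

    apply-rule : ∀ {X rhs w σ c} → Rule (X , rhs , w) → SDerivesSeq G′ rhs σ c → Relaxed σ (w + c)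
    apply-rule concatenation (snt {σ = σ₁} d₁ (snt {σ = σ₂} {c = c₂} d₂ snil)) =
      relaxed-cast (cong (σ₁ ++_) (sym (++-identityʳ σ₂))) (cong (_ +_) (sym (+-identityʳ c₂)))
        (cat (relaxed d₁) (relaxed d₂))
    apply-rule empty snil = none
    apply-rule (unpaired-rule a) (sterm (snt {σ = σ} {c = c} d snil)) =
      relaxed-cast (cong (a ∷_) (sym (++-identityʳ σ))) (cong suc (sym (+-identityʳ c))) (unpaired a (relaxed d))
    apply-rule (pair-rule xy) (sterm (snt {c = c} d (sterm snil))) =
      relaxed-cast refl (sym (+-identityʳ c)) (pair xy (relaxed d))

  derivation : ∀ {σ s} → Relaxed σ s → SDerives G′ S σ s
  derivation (cat {σ = σ} {τ = τ} {k = k} {l = l} d₁ d₂) =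
    derivation-cast (cong (σ ++_) (++-identityʳ τ)) (cong (k +_) (+-identityʳ l))
      (sder (rule-complete concatenation) (snt (derivation d₁) (snt (derivation d₂) snil)))
  derivation none = sder (rule-complete empty) snil
  derivation (unpaired {σ = σ} {s = s} x d) =
    derivation-cast (cong (x ∷_) (++-identityʳ σ)) (cong suc (+-identityʳ s))
      (sder (rule-complete (unpaired-rule x)) (sterm (snt (derivation d) snil)))
  derivation (pair {s = s} xy d) =
    derivation-cast refl (+-identityʳ s) (sder (rule-complete (pair-rule xy)) (sterm (snt (derivation d) (sterm snil))))

  score⇔distance : ∀ X σ d → HasScore G′ X σ d ⇔ IsDist IndelStep RNALang σ d
  score⇔distance zero = Distance.minimal-score⇔distance IndelStep RNALang (SDerives G′ S)
    (λ d → to-script (relaxed d)) (λ l p → let (s , s≤n , d) = from-script l p in s , s≤n , derivation d)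

  oneBD : OneBD G′
  oneBD = oneBD-from-distance letters letters-complete false G′ (λ _ → RNALang) (λ _ → rna?) score⇔distance

  -- Size: right-hand sides have length at most 3, and there are 4m + 2 productions.
  rhs-short : ∀ {p} → Rule p → suc (length (proj₁ (proj₂ p))) ≤ 4
  rhs-short concatenation = s≤s (s≤s (s≤s z≤n))
  rhs-short empty = s≤s z≤n
  rhs-short (unpaired-rule _) = s≤s (s≤s (s≤s z≤n))
  rhs-short (pair-rule _) = ≤-refl

  production-count : length productions ≡ 2 + ((m + m) + (m + m))
  production-count = cong (2 +_) (trans (length-++ unpaired-productions) (cong₂ _+_
    (trans (length-map unpaired-production letters) (#pairs inj₁ inj₂)) (#pairs pair-production pair-production′)))
    where
    #pairs : ∀ {A : Set} (f g : Fin m → A) → length (map f (allFin m) ++ map g (allFin m)) ≡ m + m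
    #pairs f g = trans (length-++ (map f (allFin m))) (cong₂ _+_ (length-map-allFin f) (length-map-allFin g))

  size : sgSize G′ ≤ 16 * (m + 1) ^ 1
  size = begin
    sgSize G′                              ≤⟨ sgSize-bound G′ 4 (All.tabulate (λ p∈ → rhs-short (rule-sound p∈))) ⟩
    1 + length productions * 4             ≡⟨ cong (λ k → 1 + k * 4) production-count ⟩
    1 + (2 + ((m + m) + (m + m))) * 4      ≤⟨ m≤m+n _ 7 ⟩
    1 + (2 + ((m + m) + (m + m))) * 4 + 7  ≡⟨ collect m ⟩
    16 * (m + 1) ^ 1                       ∎
    where
    open ≤-Reasoning
    collect : ∀ x → 1 + (2 + ((x + x) + (x + x))) * 4 + 7 ≡ 16 * ((x + 1) * 1)
    collect = solve-∀

-- Foldings of a word, with pairs of positions as natural numbers.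
module Foldings (m : ℕ) where
  open RNA m using (C; Relaxed; cat; none; unpaired; pair; G′; S; relaxed; derivation)

  Pos : Set
  Pos = ℕ × ℕ

  shift : ℕ → Pos → Pos
  shift c (i , j) = c + i , c + j

  -- Two pairs of positions are disjoint and do not cross (in either order).
  NonCrossing : Pos → Pos → Set
  NonCrossing (i , j) (k , l) =
    i ≢ k × i ≢ l × j ≢ k × j ≢ l × ¬ (i < k × k < j × j < l) × ¬ (k < i × i < l × l < j)

  nc-sym : ∀ p q → NonCrossing p q → NonCrossing q p
  nc-sym _ _ (i≢k , i≢l , j≢k , j≢l , ¬ikjl , ¬kilj) =
    (λ e → i≢k (sym e)) , (λ e → j≢k (sym e)) , (λ e → i≢l (sym e)) , (λ e → j≢l (sym e)) , ¬kilj , ¬ikjl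

  nc-shift : ∀ c p q → NonCrossing p q → NonCrossing (shift c p) (shift c q)
  nc-shift c (i , j) (k , l) (i≢k , i≢l , j≢k , j≢l , ¬ikjl , ¬kilj) =
    (λ e → i≢k (+-cancelˡ-≡ c i k e)) , (λ e → i≢l (+-cancelˡ-≡ c i l e)) ,
    (λ e → j≢k (+-cancelˡ-≡ c j k e)) , (λ e → j≢l (+-cancelˡ-≡ c j l e)) ,
    (λ (a , b , d) → ¬ikjl (+-cancelˡ-< c i k a , +-cancelˡ-< c k j b , +-cancelˡ-< c j l d)) ,
    (λ (a , b , d) → ¬kilj (+-cancelˡ-< c k i a , +-cancelˡ-< c i l b , +-cancelˡ-< c l j d))

  nc-unshift : ∀ c p q → NonCrossing (shift c p) (shift c q) → NonCrossing p q
  nc-unshift c (i , j) (k , l) (i≢k , i≢l , j≢k , j≢l , ¬ikjl , ¬kilj) =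
    (λ e → i≢k (cong (c +_) e)) , (λ e → i≢l (cong (c +_) e)) ,
    (λ e → j≢k (cong (c +_) e)) , (λ e → j≢l (cong (c +_) e)) ,
    (λ (a , b , d) → ¬ikjl (+-monoʳ-< c a , +-monoʳ-< c b , +-monoʳ-< c d)) ,
    (λ (a , b , d) → ¬kilj (+-monoʳ-< c a , +-monoʳ-< c b , +-monoʳ-< c d))

  nc-before : ∀ {i j k l} → i < j → j < k → k < l → NonCrossing (i , j) (k , l)
  nc-before i<j j<k k<l =
    (λ { refl → <-irrefl refl (<-trans i<j j<k) }) , (λ { refl → <-irrefl refl (<-trans i<j (<-trans j<k k<l)) }) ,
    (λ { refl → <-irrefl refl j<k }) , (λ { refl → <-irrefl refl (<-trans j<k k<l) }) ,
    (λ (_ , k<j , _) → <-asym k<j j<k) , (λ (k<i , _ , _) → <-asym k<i (<-trans i<j j<k))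

  nc-nested : ∀ {i j k l} → i < k → k < l → l < j → NonCrossing (i , j) (k , l)
  nc-nested i<k k<l l<j =
    (λ { refl → <-irrefl refl i<k }) , (λ { refl → <-irrefl refl (<-trans i<k k<l) }) ,
    (λ { refl → <-irrefl refl (<-trans k<l l<j) }) , (λ { refl → <-irrefl refl l<j }) ,
    (λ (_ , _ , j<l) → <-asym j<l l<j) , (λ (k<i , _ , _) → <-asym k<i i<k)

  at : List C → ℕ → Maybe C
  at [] _ = nothing
  at (x ∷ σ) zero = just x
  at (x ∷ σ) (suc i) = at σ i

  at-++ˡ : ∀ σ τ i {x} → at σ i ≡ just x → at (σ ++ τ) i ≡ just x
  at-++ˡ (y ∷ σ) τ zero e = e
  at-++ˡ (y ∷ σ) τ (suc i) e = at-++ˡ σ τ i e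

  at-++ʳ : ∀ σ τ k → at (σ ++ τ) (length σ + k) ≡ at τ k
  at-++ʳ [] τ k = refl
  at-++ʳ (y ∷ σ) τ k = at-++ʳ σ τ k

  at-++-< : ∀ σ τ i → i < length σ → at (σ ++ τ) i ≡ at σ i
  at-++-< (y ∷ σ) τ zero _ = refl
  at-++-< (y ∷ σ) τ (suc i) (s≤s i<) = at-++-< σ τ i i<

  at-bound : ∀ σ i {x} → at σ i ≡ just x → i < length σ
  at-bound (y ∷ σ) zero e = s≤s z≤n
  at-bound (y ∷ σ) (suc i) e = s≤s (at-bound σ i e)

  at-split : ∀ σ j {y} → at σ j ≡ just y → ∃ λ σ₁ → ∃ λ σ₂ → σ ≡ σ₁ ++ y ∷ σ₂ × length σ₁ ≡ j
  at-split (x ∷ σ) zero refl = [] , σ , refl , refl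
  at-split (x ∷ σ) (suc j) e with at-split σ j e
  ... | σ₁ , σ₂ , refl , refl = x ∷ σ₁ , σ₂ , refl , refl

  Pairing : List C → Pos → Set
  Pairing σ (i , j) = i < j × ∃ λ x → ∃ λ y → at σ i ≡ just x × at σ j ≡ just y × Matches x y

  Folding : List C → List Pos → Set
  Folding σ qs = All (Pairing σ) qs × AllPairs NonCrossing qs

  pairing-bound : ∀ σ {q} → Pairing σ q → proj₂ q < length σ
  pairing-bound σ {_ , j} (_ , _ , _ , _ , e , _) = at-bound σ j e

  pairing-++ˡ : ∀ σ τ {q} → Pairing σ q → Pairing (σ ++ τ) q
  pairing-++ˡ σ τ {i , j} (i<j , x , y , ex , ey , xy) = i<j , x , y , at-++ˡ σ τ i ex , at-++ˡ σ τ j ey , xy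

  pairing-restrict : ∀ σ τ {q} → proj₂ q < length σ → Pairing (σ ++ τ) q → Pairing σ q
  pairing-restrict σ τ {i , j} j< (i<j , x , y , ex , ey , xy) =
    i<j , x , y , trans (sym (at-++-< σ τ i (<-trans i<j j<))) ex , trans (sym (at-++-< σ τ j j<)) ey , xy

  pairing-shift : ∀ σ τ {q} → Pairing τ q → Pairing (σ ++ τ) (shift (length σ) q)
  pairing-shift σ τ {i , j} (i<j , x , y , ex , ey , xy) =
    +-monoʳ-< (length σ) i<j , x , y , trans (at-++ʳ σ τ i) ex , trans (at-++ʳ σ τ j) ey , xy

  pairing-unshift : ∀ σ τ {q} → Pairing (σ ++ τ) (shift (length σ) q) → Pairing τ q
  pairing-unshift σ τ {i , j} (i<j , x , y , ex , ey , xy) =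
    +-cancelˡ-< (length σ) i j i<j , x , y , trans (sym (at-++ʳ σ τ i)) ex , trans (sym (at-++ʳ σ τ j)) ey , xy

  folding-shift : ∀ σ τ {qs} → Folding τ qs → Folding (σ ++ τ) (map (shift (length σ)) qs)
  folding-shift σ τ (pairings , nc) =
    All.map⁺ (All.map (pairing-shift σ τ) pairings) ,
    AllPairs.map⁺ (AllPairs.map (λ {p} {q} → nc-shift (length σ) p q) nc)

  folding-unshift : ∀ σ τ {qs} → Folding (σ ++ τ) (map (shift (length σ)) qs) → Folding τ qs
  folding-unshift σ τ (pairings , nc) =
    All.map (pairing-unshift σ τ) (All.map⁻ pairings) ,
    AllPairs.map (λ {p} {q} → nc-unshift (length σ) p q) (AllPairs.map⁻ nc)

  -- A relaxed derivation of score s yields a folding with at least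
  -- (|σ| - s)/2 pairs: every letter not left unpaired is matched.
  folding-of : ∀ {σ s} → Relaxed σ s → ∃ λ qs → Folding σ qs × length σ ≤ s + 2 * length qs
  folding-of (cat {σ = σ} {τ} {k} {l} d₁ d₂) with folding-of d₁ | folding-of d₂
  ... | qs₁ , (pairings₁ , nc₁) , count₁ | qs₂ , f₂ , count₂ =
    qs₁ ++ qs₂′ ,
    (All.++⁺ (All.map (pairing-++ˡ σ τ) pairings₁) pairings₂′ ,
     AllPairs.++⁺ nc₁ nc₂′ (All.map (λ p → All.map⁺ (All.map (λ q → separate p q) (proj₁ f₂))) pairings₁)) ,
    (begin
      length (σ ++ τ)                                   ≡⟨ length-++ σ ⟩
      length σ + length τ                               ≤⟨ +-mono-≤ count₁ count₂ ⟩
      (k + 2 * length qs₁) + (l + 2 * length qs₂)       ≡⟨ regroup k l (length qs₁) (length qs₂) ⟩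
      (k + l) + 2 * (length qs₁ + length qs₂)           ≡⟨ cong (λ n → (k + l) + 2 * (length qs₁ + n)) (sym (length-map _ qs₂)) ⟩
      (k + l) + 2 * (length qs₁ + length qs₂′)          ≡⟨ cong (λ n → (k + l) + 2 * n) (sym (length-++ qs₁)) ⟩
      (k + l) + 2 * length (qs₁ ++ qs₂′)                ∎)
    where
    open ≤-Reasoning
    qs₂′ = map (shift (length σ)) qs₂
    pairings₂′ = proj₁ (folding-shift σ τ f₂)
    nc₂′ = proj₂ (folding-shift σ τ f₂)
    separate : ∀ {p q} → Pairing σ p → Pairing τ q → NonCrossing p (shift (length σ) q)
    separate {i , j} {k , l} p q =
      nc-before (proj₁ p) (<-≤-trans (pairing-bound σ p) (m≤m+n (length σ) k)) (+-monoʳ-< (length σ) (proj₁ q))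
    regroup : ∀ a b x y → (a + 2 * x) + (b + 2 * y) ≡ (a + b) + 2 * (x + y)
    regroup = solve-∀
  folding-of none = [] , ([] , []) , z≤n
  folding-of (unpaired {σ = σ} {s = s} x d) with folding-of d
  ... | qs , f , count =
    map (shift 1) qs , folding-shift [ x ] σ f , s≤s (subst (λ n → length σ ≤ s + 2 * n) (sym (length-map _ qs)) count)
  folding-of (pair {σ = σ} {s = s} {x = x} {y = y} xy d) with folding-of d
  ... | qs , f , count =
    (0 , suc (length σ)) ∷ map (shift 1) qs ,
    (outer ∷ proj₁ inner , All.map⁺ (All.map (λ {q} p → enclosing q p) (proj₁ f)) ∷ proj₂ inner) ,
    (begin
      length (x ∷ σ ++ [ y ])              ≡⟨ cong suc (length-++-sucʳ σ y []) ⟩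
      2 + length (σ ++ [])                 ≡⟨ cong (λ w → 2 + length w) (++-identityʳ σ) ⟩
      2 + length σ                         ≤⟨ s≤s (s≤s count) ⟩
      2 + (s + 2 * length qs)              ≡⟨ regroup s (length qs) ⟩
      s + 2 * suc (length qs)              ≡⟨ cong (λ n → s + 2 * suc n) (sym (length-map _ qs)) ⟩
      s + 2 * suc (length (map (shift 1) qs)) ∎)
    where
    open ≤-Reasoning
    inner : Folding (x ∷ σ ++ [ y ]) (map (shift 1) qs)
    inner = folding-shift [ x ] (σ ++ [ y ]) (All.map (pairing-++ˡ σ [ y ]) (proj₁ f) , proj₂ f)
    outer : Pairing (x ∷ σ ++ [ y ]) (0 , suc (length σ))
    outer = s≤s z≤n , x , y , refl , trans (cong (at (σ ++ [ y ])) (sym (+-identityʳ (length σ)))) (at-++ʳ σ [ y ] 0) , xy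
    enclosing : ∀ q → Pairing σ q → NonCrossing (0 , suc (length σ)) (shift 1 q)
    enclosing (i , j) p = nc-nested (s≤s z≤n) (s≤s (proj₁ p)) (s≤s (pairing-bound σ p))
    regroup : ∀ a n → 2 + (a + 2 * n) ≡ a + 2 * suc n
    regroup = solve-∀

  unshift : ∀ c qs → All (λ q → c ≤ proj₁ q × c ≤ proj₂ q) qs → ∃ λ qs′ → qs ≡ map (shift c) qs′
  unshift c [] [] = [] , refl
  unshift c ((i , j) ∷ qs) ((c≤i , c≤j) ∷ rest) with unshift c qs rest
  ... | qs′ , refl =
    (i ∸ c , j ∸ c) ∷ qs′ ,
    cong₂ (λ a b → (a , b) ∷ map (shift c) qs′) (sym (m+[n∸m]≡n c≤i)) (sym (m+[n∸m]≡n c≤j))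

  one-starts-at : ∀ {i Z} → All (λ q → proj₁ q ≡ i) Z → AllPairs NonCrossing Z → length Z ≤ 1
  one-starts-at [] _ = z≤n
  one-starts-at (_ ∷ []) _ = ≤-refl
  one-starts-at (refl ∷ e ∷ _) ((nc ∷ _) ∷ _) = ⊥-elim (proj₁ nc (sym e))

  folding-restrict : ∀ σ τ {qs} → All (λ q → proj₂ q < length σ) qs → Folding (σ ++ τ) qs → Folding σ qs
  folding-restrict σ τ bounds (pairings , nc) = All.zipWith (λ (b , p) → pairing-restrict σ τ b p) (bounds , pairings) , nc

  after : ∀ {j i l} → NonCrossing (0 , j) (i , l) → i ≢ 0 → ¬ l < j → j < i
  after (_ , _ , j≢i , j≢l , ¬crossing , _) i≢0 l≮j = ≤∧≢⇒< (≮⇒≥ λ i<j → ¬crossing (0<i , i<j , j<l)) j≢i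
    where
    0<i = ≤∧≢⇒< z≤n (λ e → i≢0 (sym e))
    j<l = ≤∧≢⇒< (≮⇒≥ l≮j) j≢l

  positive : ∀ {i l} → i ≢ 0 → i < l → 1 ≤ i × 1 ≤ l
  positive i≢0 i<l = 0<i , <-trans 0<i i<l
    where
    0<i = ≤∧≢⇒< z≤n (λ e → i≢0 (sym e))

  from-0? : Decidable (λ (q : Pos) → proj₁ q ≡ 0)
  from-0? q = proj₁ q ≟ⁿ 0

  ends-before? : ∀ j → Decidable (λ (q : Pos) → proj₂ q < j)
  ends-before? j q = proj₂ q <? j

  -- Splitting a folding at a pair (0 , j): apart from it, every pair lies
  -- strictly inside it or strictly after it, giving foldings of both parts.
  split-at-pair : ∀ x y σ₁ σ₂ {qs} → (0 , suc (length σ₁)) ∈ qs → Folding (x ∷ σ₁ ++ y ∷ σ₂) qs →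
    ∃ λ I → ∃ λ O → Folding σ₁ I × Folding σ₂ O × length qs ≤ 1 + (length I + length O)
  split-at-pair x y σ₁ σ₂ {qs} outer∈ (pairings , nc) =
    I , O , folding-I , folding-O ,
    (begin
      length qs                                   ≡⟨ length-filter-split from-0? qs ⟩
      length Z + length rest                      ≡⟨ cong (length Z +_) (length-filter-split (ends-before? j) rest) ⟩
      length Z + (length inside + length outside) ≤⟨ +-mono-≤ (one-starts-at (All.all-filter from-0? qs) (AllPairs.filter⁺ from-0? nc))
                                                       (≤-reflexive (cong₂ _+_ (#shifted I≡) (#shifted O≡))) ⟩
      1 + (length I + length O)                   ∎)
    where
    open ≤-Reasoning
    σ = x ∷ σ₁ ++ y ∷ σ₂
    j = suc (length σ₁)
    Z = filter from-0? qs
    rest = filter (λ q → ¬? (from-0? q)) qs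
    inside = filter (ends-before? j) rest
    outside = filter (λ q → ¬? (ends-before? j q)) rest

    rest-ok : All (λ q → proj₁ q ≢ 0 × Pairing σ q) rest
    rest-ok = All.zip (All.all-filter _ qs , All.filter⁺ _ pairings)
    rest-nc : AllPairs NonCrossing rest
    rest-nc = AllPairs.filter⁺ _ nc

    #shifted : ∀ {c ps qs′} → ps ≡ map (shift c) qs′ → length ps ≡ length qs′
    #shifted {c} {qs′ = qs′} refl = length-map (shift c) qs′

    inside-ok = All.filter⁺ (ends-before? j) rest-ok
    I-split = unshift 1 inside (All.map (λ (i≢0 , p) → positive i≢0 (proj₁ p)) inside-ok)
    I = proj₁ I-split
    I≡ = proj₂ I-split
    folding-I : Folding σ₁ I
    folding-I =
      folding-restrict σ₁ (y ∷ σ₂)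
        (All.map (λ { (s≤s l<) → l< }) (All.map⁻ (subst (All _) I≡ (All.all-filter (ends-before? j) rest))))
        (folding-unshift [ x ] (σ₁ ++ y ∷ σ₂)
          (subst (Folding σ) I≡ (All.map proj₂ inside-ok , AllPairs.filter⁺ _ rest-nc)))

    outside-ok = All.filter⁺ (λ q → ¬? (ends-before? j q)) rest-ok
    outside-nc : All (NonCrossing (0 , j)) outside
    outside-nc = All.tabulate λ {q} q∈ →
      let q∈rest , _ = ∈-filter⁻ (λ q → ¬? (ends-before? j q)) q∈
          q∈qs , i≢0 = ∈-filter⁻ (λ q → ¬? (from-0? q)) q∈rest
      in [ (λ nc′ → nc′) , nc-sym q (0 , j) ]′ (allPairs-∈ nc outer∈ q∈qs λ e → i≢0 (cong proj₁ (sym e)))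
    O-split = unshift (suc j) outside (All.zipWith (λ { ((i≢0 , p) , l≮j , nc′) → beyond i≢0 p l≮j nc′ })
                                           (outside-ok , All.zip (All.all-filter _ rest , outside-nc)))
      where
      beyond : ∀ {i l} → i ≢ 0 → Pairing σ (i , l) → ¬ l < j → NonCrossing (0 , j) (i , l) →
               suc j ≤ i × suc j ≤ l
      beyond i≢0 p l≮j nc′ = after nc′ i≢0 l≮j , <-trans (after nc′ i≢0 l≮j) (proj₁ p)
    O = proj₁ O-split
    O≡ = proj₂ O-split
    prefix = x ∷ σ₁ ++ [ y ]
    folding-O : Folding σ₂ O
    folding-O = folding-unshift prefix σ₂
      (subst₂ (λ w c → Folding w (map (shift c) O)) (sym (cong (x ∷_) (++-assoc σ₁ [ y ] σ₂))) (sym #prefix)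
        (subst (Folding σ) O≡ (All.map proj₂ outside-ok , AllPairs.filter⁺ _ rest-nc)))
      where
      #prefix : length prefix ≡ suc j
      #prefix = cong suc (trans (length-++ σ₁) (+-comm (length σ₁) 1))

  -- A folding with k pairs yields a relaxed derivation of score at most
  -- |σ| - 2k: the first letter is either unpaired, or paired with some y,
  -- splitting the word into the parts inside and after that pair.
  relaxed-of : ∀ n σ → length σ ≤ n → ∀ qs → Folding σ qs →
               ∃ λ s → Relaxed σ s × s + 2 * length qs ≤ length σ
  relaxed-of _ [] _ [] _ = 0 , none , z≤n
  relaxed-of _ [] _ (_ ∷ _) (p ∷ _ , _) with pairing-bound [] p
  ... | ()
  relaxed-of zero (_ ∷ _) () _ _
  relaxed-of (suc n) (x ∷ r) (s≤s r≤n) qs f@(pairings , nc) with any? from-0? qs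
  ... | no ¬from-0
    with unshift 1 qs (All.zipWith (λ (i≢0 , p) → positive i≢0 (proj₁ p)) (All.¬Any⇒All¬ qs ¬from-0 , pairings))
  ...   | qs′ , refl with relaxed-of n r r≤n qs′ (folding-unshift [ x ] r f)
  ...     | s , d , count = suc s , unpaired x d , s≤s (subst (λ k → s + 2 * k ≤ length r) (sym (length-map _ qs′)) count)
  relaxed-of (suc n) (x ∷ r) (s≤s r≤n) qs f@(pairings , nc) | yes some-from-0 with find some-from-0
  ... | (_ , j) , q∈ , refl with lookupAll pairings q∈
  ...   | s≤s z≤n , _ , y , refl , at-j , xy with at-split r _ at-j
  ...     | σ₁ , σ₂ , refl , refl with split-at-pair x y σ₁ σ₂ q∈ f
  ...       | I , O , f₁ , f₂ , #qs
    with relaxed-of n σ₁ (≤-trans (length-++-≤ˡ σ₁) r≤n) I f₁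
       | relaxed-of n σ₂ (≤-trans (≤-trans (n≤1+n _) (length-++-≤ʳ (y ∷ σ₂) {σ₁})) r≤n) O f₂
  ... | s₁ , d₁ , count₁ | s₂ , d₂ , count₂ =
    s₁ + s₂ , subst (λ w → Relaxed w (s₁ + s₂)) (cong (x ∷_) (++-assoc σ₁ [ y ] σ₂)) (cat (pair xy d₁) d₂) ,
    (begin
      (s₁ + s₂) + 2 * length qs                         ≤⟨ +-monoʳ-≤ (s₁ + s₂) (*-monoʳ-≤ 2 #qs) ⟩
      (s₁ + s₂) + 2 * (1 + (length I + length O))       ≡⟨ regroup s₁ s₂ (length I) (length O) ⟩
      2 + ((s₁ + 2 * length I) + (s₂ + 2 * length O))   ≤⟨ +-monoʳ-≤ 2 (+-mono-≤ count₁ count₂) ⟩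
      2 + (length σ₁ + length σ₂)                       ≡⟨ cong suc (sym (trans (length-++-sucʳ σ₁ y σ₂) (cong suc (length-++ σ₁)))) ⟩
      length (x ∷ σ₁ ++ y ∷ σ₂)                         ∎)
    where
    open ≤-Reasoning
    regroup : ∀ a b k l → (a + b) + 2 * (1 + (k + l)) ≡ 2 + ((a + 2 * k) + (b + 2 * l))
    regroup = solve-∀

  -- Translation between foldings with Fin positions (as in IsFolding) and
  -- foldings with natural-number positions; it preserves the number of pairs.
  pos : ∀ {n} → Fin n × Fin n → Pos
  pos (i , j) = toℕ i , toℕ j

  at-lookup : ∀ σ (i : Fin (length σ)) → at σ (toℕ i) ≡ just (lookup σ i)
  at-lookup (x ∷ σ) zero = refl
  at-lookup (x ∷ σ) (suc i) = at-lookup σ i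

  lookup-at : ∀ σ (f : Fin (length σ)) {i x} → toℕ f ≡ i → at σ i ≡ just x → lookup σ f ≡ x
  lookup-at σ f refl e = just-injective (trans (sym (at-lookup σ f)) e)

  allPairs-lookup : ∀ {A : Set} {R : A → A → Set} → (∀ {x y} → R x y → R y x) →
    ∀ {xs} → AllPairs R xs → ∀ a b → a ≢ b → R (lookup xs a) (lookup xs b)
  allPairs-lookup R-sym (_ ∷ _) zero zero a≢b = ⊥-elim (a≢b refl)
  allPairs-lookup R-sym (Rx ∷ _) zero (suc b) _ = lookupAll Rx (∈-lookup b)
  allPairs-lookup R-sym (Rx ∷ _) (suc a) zero _ = R-sym (lookupAll Rx (∈-lookup a))
  allPairs-lookup R-sym (_ ∷ rest) (suc a) (suc b) a≢b = allPairs-lookup R-sym rest a b (λ e → a≢b (cong suc e))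

  to-folding : ∀ σ ps → IsFolding σ ps → Folding σ (map pos ps)
  to-folding σ ps (matching , compatible) =
    All.map⁺ (All.map (λ {p} → pairing (proj₁ p) (proj₂ p)) matching) ,
    AllPairs.map⁺ (subst (AllPairs _) (tabulate-lookup ps) (AllPairs.tabulate⁺ λ {a} {b} a≢b →
      non-crossing (lookup ps a) (lookup ps b) (compatible a b a≢b) (compatible b a (λ e → a≢b (sym e)))))
    where
    pairing : ∀ i j → i F.< j × Matches (lookup σ i) (lookup σ j) → Pairing σ (pos (i , j))
    pairing i j (i<j , xy) = i<j , lookup σ i , lookup σ j , at-lookup σ i , at-lookup σ j , xy
    non-crossing : ∀ p q → Compatible p q → Compatible q p → NonCrossing (pos p) (pos q)
    non-crossing (i , j) (k , l) (i≢k , i≢l , j≢k , j≢l , ¬ikjl) (_ , _ , _ , _ , ¬kilj) =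
      (λ e → i≢k (toℕ-injective e)) , (λ e → i≢l (toℕ-injective e)) ,
      (λ e → j≢k (toℕ-injective e)) , (λ e → j≢l (toℕ-injective e)) , ¬ikjl , ¬kilj

  module _ (σ : List C) where

    fin-pairs : ∀ qs → All (Pairing σ) qs → List (Fin (length σ) × Fin (length σ))
    fin-pairs [] [] = []
    fin-pairs ((i , j) ∷ qs) (p ∷ ps) =
      (fromℕ< (<-trans (proj₁ p) (pairing-bound σ p)) , fromℕ< (pairing-bound σ p)) ∷ fin-pairs qs ps

    fin-pairs-pos : ∀ qs ps → map pos (fin-pairs qs ps) ≡ qs
    fin-pairs-pos [] [] = refl
    fin-pairs-pos ((i , j) ∷ qs) (p ∷ ps) = cong₂ _∷_ (cong₂ _,_ (toℕ-fromℕ< _) (toℕ-fromℕ< _)) (fin-pairs-pos qs ps)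

    fin-pairs-matching : ∀ qs ps → All (λ { (i , j) → i F.< j × Matches (lookup σ i) (lookup σ j) }) (fin-pairs qs ps)
    fin-pairs-matching [] [] = []
    fin-pairs-matching ((i , j) ∷ qs) ((i<j , x , y , ex , ey , xy) ∷ ps) =
      (subst₂ _<_ (sym (toℕ-fromℕ< _)) (sym (toℕ-fromℕ< _)) i<j ,
       subst₂ Matches (sym (lookup-at σ _ (toℕ-fromℕ< _) ex)) (sym (lookup-at σ _ (toℕ-fromℕ< _) ey)) xy)
      ∷ fin-pairs-matching qs ps

    from-folding : ∀ qs → Folding σ qs → ∃ λ ps → IsFolding σ ps × length ps ≡ length qs
    from-folding qs (pairings , nc) =
      ps , (fin-pairs-matching qs pairings , λ a b a≢b → compatible (lookup ps a) (lookup ps b)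
             (allPairs-lookup (λ {p} {q} → nc-sym (pos p) (pos q)) nc′ a b a≢b)) ,
      trans (sym (length-map pos ps)) (cong length (fin-pairs-pos qs pairings))
      where
      ps = fin-pairs qs pairings
      nc′ : AllPairs (λ p q → NonCrossing (pos p) (pos q)) ps
      nc′ = AllPairs.map⁻ (subst (AllPairs NonCrossing) (sym (fin-pairs-pos qs pairings)) nc)
      compatible : ∀ p q → NonCrossing (pos p) (pos q) → Compatible p q
      compatible (i , j) (k , l) (i≢k , i≢l , j≢k , j≢l , ¬ikjl , _) =
        (λ e → i≢k (cong toℕ e)) , (λ e → i≢l (cong toℕ e)) ,
        (λ e → j≢k (cong toℕ e)) , (λ e → j≢l (cong toℕ e)) , ¬ikjl

  -- If the RNA-folding value of σ is k, the score of σ is |σ| - 2k: a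
  -- maximum folding gives a derivation of score at most |σ| - 2k, and any
  -- derivation of score d gives a folding, of at most k pairs, so |σ| ≤ d + 2k.
  folding-score : ∀ σ k → IsRNAFold σ k → HasScore G′ S σ (length σ ∸ 2 * k)
  folding-score σ k ((ps , is-folding , #ps) , maximal) =
    subst (SDerives G′ S σ) s≡ (derivation d) , lower
    where
    qs = map pos ps
    #qs : length qs ≡ k
    #qs = trans (length-map pos ps) #ps
    best = relaxed-of (length σ) σ ≤-refl qs (to-folding σ ps is-folding)
    s = proj₁ best
    d = proj₁ (proj₂ best)

    lower : ∀ d′ → SDerives G′ S σ d′ → length σ ∸ 2 * k ≤ d′
    lower d′ der with folding-of (relaxed der)
    ... | qs′ , f′ , count′ with from-folding σ qs′ f′
    ...   | ps′ , is-folding′ , #ps′ = m≤n+o⇒m∸n≤o (length σ) (2 * k)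
      (≤-trans count′ (≤-trans (+-monoʳ-≤ d′ (*-monoʳ-≤ 2 (subst (_≤ k) #ps′ (maximal ps′ is-folding′))))
                               (≤-reflexive (+-comm d′ (2 * k)))))

    s≡ : s ≡ length σ ∸ 2 * k
    s≡ = ≤-antisym (m+n≤o⇒m≤o∸n s (subst (λ n → s + 2 * n ≤ length σ) #qs (proj₂ (proj₂ best))))
                   (lower s (derivation d))

proposition1 :
    -- Language edit distance (insertions, deletions, substitutions)
    (∃ λ (c : ℕ) → ∃ λ (e : ℕ) → ∀ (t : ℕ) (G : CNF (Fin t)) →
      Σ (ScoredGrammar (Fin t)) λ G' →
        sgSize G' ≤ c * (cnfSize G) ^ e × OneBD G' ×
        (∀ (σ : List (Fin t)) (d : ℕ) →
          (HasScore G' (sstart G') σ d ⇔ IsDist EditStep (Lang G) σ d))) ×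
    -- Language edit distance (insertions and deletions only)
    (∃ λ (c : ℕ) → ∃ λ (e : ℕ) → ∀ (t : ℕ) (G : CNF (Fin t)) →
      Σ (ScoredGrammar (Fin t)) λ G' →
        sgSize G' ≤ c * (cnfSize G) ^ e × OneBD G' ×
        (∀ (σ : List (Fin t)) (d : ℕ) →
          (HasScore G' (sstart G') σ d ⇔ IsDist IndelStep (Lang G) σ d))) ×
    -- RNA-folding
    (∃ λ (c : ℕ) → ∃ λ (e : ℕ) → ∀ (m : ℕ) →
      Σ (ScoredGrammar (RNAChar m)) λ G' →
        sgSize G' ≤ c * (m + 1) ^ e × OneBD G' ×
        (∀ (σ : List (RNAChar m)) (d : ℕ) →
          (HasScore G' (sstart G') σ d ⇔ IsDist IndelStep RNALang σ d)) ×
        (∀ (σ : List (RNAChar m)) (k : ℕ) →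
          IsRNAFold σ k → HasScore G' (sstart G') σ (length σ ∸ 2 * k)))
proposition1 =
  (22 , 2 , λ t G → LED.G′ G true , LED.size G true , LED.oneBD G true , LED.score⇔distance G true (start G)) ,
  (22 , 2 , λ t G → LED.G′ G false , LED.size G false , LED.oneBD G false , LED.score⇔distance G false (start G)) ,
  (16 , 1 , λ m → RNA.G′ m , RNA.size m , RNA.oneBD m , RNA.score⇔distance m zero , Foldings.folding-score m)
  where
  module LED = LanguageEditDistance
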